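{- Let $G$ be a virtual spatial graph. Then $c(G)\ge\frac13\bigl(\operatorname{span}R(G)-2\beta_1(G)\bigr)$.
   Context: $c(G)$ is the crossing number of $G$: the minimum number of classical crossings over all diagrams of $G$ (diagrams being generic immersions of the graph in the plane with classical and virtual crossings). $\beta_1(G)$ is the first Betti number of the underlying abstract graph. For a diagram $D$: at each classical crossing one may take the A-resolution, B-resolution (the two Kauffman smoothings) or X-resolution (replace the crossing by a 4-valent vertex); a state $S$ is a choice of resolution at each classical crossing viewed as an abstract graph (virtual crossings are not vertices), $a(S),b(S)$ count A- and B-resolutions, $H(S)=\sum_{F\subseteq E(S)}(-1)^{\beta_0(S-F)}(-A-2-A^{ -1})^{\beta_1(S-F)}$, and the Yamada polynomial is $R(D)=\sum_S A^{a(S)-b(S)}H(S)$. $\operatorname{span}R(G)$ is the difference between the maximal and minimal exponents of $A$ with nonzero coefficient in $R(D)$ for a diagram $D$ of $G$. -}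

module Defs where

open import Data.Bool using (Bool; true; false; _∧_; _∨_; if_then_else_)
open import Data.Nat as ℕ using (ℕ; zero; suc; _∸_)
open import Data.Integer as ℤ using (ℤ)
open import Data.Fin using (Fin; zero; suc)
open import Data.Fin.Properties using () renaming (_≟_ to _≟F_)
open import Data.List using (List; []; _∷_; _++_; map; concatMap; length; allFin; foldr; reverse; replicate)
open import Data.Bool.ListAction using (any)
open import Data.Vec using (Vec; []; _∷_; lookup; toList)
open import Data.Product using (_×_; _,_; proj₁; proj₂; Σ)
open import Data.Sum using (_⊎_; inj₁; inj₂)
import Data.Sum.Properties as SumP
import Data.Product.Properties as ProdP
open import Relation.Binary.Definitions using (DecidableEquality)
open import Relation.Nullary.Decidable using (⌊_⌋)
open import Relation.Binary.PropositionalEquality using (_≡_)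

-- ordinary polynomials: coefficient list, lowest degree first
Poly : Set
Poly = List ℤ

addP : Poly → Poly → Poly
addP [] q = q
addP (a ∷ p) [] = a ∷ p
addP (a ∷ p) (b ∷ q) = (a ℤ.+ b) ∷ addP p q

mulP : Poly → Poly → Poly
mulP [] q = []
mulP (a ∷ p) q = addP (map (a ℤ.*_) q) (ℤ.0ℤ ∷ mulP p q)

-- lp k p  denotes  Σ_i p[i] A^(k+i)
record Laurent : Set where
  constructor lp
  field
    low    : ℤ
    coeffs : Poly

addL : Laurent → Laurent → Laurent
addL (lp k p) (lp l q) =
  lp (k ℤ.⊓ l) (addP (replicate ℤ.∣ k ℤ.- (k ℤ.⊓ l) ∣ ℤ.0ℤ ++ p)
                     (replicate ℤ.∣ l ℤ.- (k ℤ.⊓ l) ∣ ℤ.0ℤ ++ q))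

mulL : Laurent → Laurent → Laurent
mulL (lp k p) (lp l q) = lp (k ℤ.+ l) (mulP p q)

zeroL oneL : Laurent
zeroL = lp ℤ.0ℤ []
oneL  = lp ℤ.0ℤ (ℤ.1ℤ ∷ [])

monoA : ℤ → Laurent
monoA k = lp k (ℤ.1ℤ ∷ [])

powL : Laurent → ℕ → Laurent
powL x zero    = oneL
powL x (suc n) = mulL x (powL x n)

sumL : List Laurent → Laurent
sumL = foldr addL zeroL

signL : ℕ → Laurent
signL n = powL (lp ℤ.0ℤ (ℤ.-1ℤ ∷ [])) n

-- the variable  -A - 2 - A^{-1}
xL : Laurent
xL = lp ℤ.-1ℤ (ℤ.-1ℤ ∷ ℤ.- (ℤ.+ 2) ∷ ℤ.-1ℤ ∷ [])

-- span: (max exponent with nonzero coefficient) - (min such exponent);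
-- convention: 0 for the zero polynomial
isZero : ℤ → Bool
isZero z = ⌊ z ℤ.≟ ℤ.0ℤ ⌋

dropZeros : Poly → Poly
dropZeros [] = []
dropZeros (a ∷ p) = if isZero a then dropZeros p else a ∷ p

trim : Poly → Poly
trim p = reverse (dropZeros (reverse (dropZeros p)))

span : Laurent → ℕ
span (lp _ p) = length (trim p) ∸ 1

-- Finite abstract (multi)graphs: a vertex list and an edge list
-- (loops and multiple edges allowed); Betti numbers and the H-polynomial.

module GraphInv {V : Set} (_≟_ : DecidableEquality V) where

  eqb : V → V → Bool
  eqb u v = ⌊ u ≟ v ⌋

  adj : List (V × V) → V → V → Bool
  adj es u v = any (λ e → (eqb (proj₁ e) u ∧ eqb (proj₂ e) v)
                          ∨ (eqb (proj₁ e) v ∧ eqb (proj₂ e) u)) es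

  reach : List V → List (V × V) → ℕ → V → V → Bool
  reach vs es zero    u v = eqb u v
  reach vs es (suc k) u v =
    reach vs es k u v ∨ any (λ w → reach vs es k u w ∧ adj es w v) vs

  connected : List V → List (V × V) → V → V → Bool
  connected vs es u v = reach vs es (length vs) u v

  comps : List V → List (V × V) → List V → List V → ℕ
  comps vs es seen [] = 0
  comps vs es seen (v ∷ rest) =
    if any (λ w → connected vs es w v) seen
    then comps vs es (v ∷ seen) rest
    else suc (comps vs es (v ∷ seen) rest)

  β₀ : List V → List (V × V) → ℕ
  β₀ vs es = comps vs es [] vs

  β₁ : List V → List (V × V) → ℕ
  β₁ vs es = (length es ℕ.+ β₀ vs es) ∸ length vs

  sublists : List (V × V) → List (List (V × V))
  sublists [] = [] ∷ []
  sublists (e ∷ es) = sublists es ++ map (e ∷_) (sublists es)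

  -- H(S) = Σ_{F ⊆ E} (-1)^β₀(S-F) x^β₁(S-F); here K ranges over the
  -- edge sets E∖F of the spanning subgraphs S-F
  H : List V → List (V × V) → Laurent
  H vs es = sumL (map (λ K → mulL (signL (β₀ vs K)) (powL xL (β₁ vs K)))
                      (sublists es))

-- Virtual crossings carry no information for c, β₁ and R, so a diagram is
-- recorded (up to virtual moves / planar isotopy) by: graph vertices
-- Fin nv, classical crossings Fin nc, each crossing having 4 slots
-- numbered 0,1,2,3 counterclockwise with the over-strand through slots 0,2
-- and the under-strand through slots 1,3, and edges Fin ne, each with two
-- ends attached to graph vertices or crossing slots; every crossing slot
-- is the end of exactly one edge end.

data End (nv nc : ℕ) : Set where
  vert : Fin nv → End nv nc
  slot : Fin nc → Fin 4 → End nv nc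

record Diagram : Set where
  field
    nv nc ne : ℕ
    end : Fin ne → Fin 2 → End nv nc
    slotsOnce : (i : Fin nc) (k : Fin 4) →
      Σ (Fin ne × Fin 2) λ p →
        (end (proj₁ p) (proj₂ p) ≡ slot i k) ×
        ((q : Fin ne × Fin 2) → end (proj₁ q) (proj₂ q) ≡ slot i k → q ≡ p)
open Diagram public

-- resolutions of a classical crossing: A-, B-smoothing, X (4-valent vertex),
-- and P ("pass": keep the two strands, used for the underlying graph)
data Res : Set where
  rA rB rX rP : Res

-- for a smoothing-type resolution, which of the two arcs a slot lies on
-- A: arcs {1,2},{3,0};  B: arcs {0,1},{2,3};  P: strands {0,2},{1,3}
arcOf : Res → Fin 4 → Fin 2
arcOf rA zero = suc zero
arcOf rA (suc zero) = zero
arcOf rA (suc (suc zero)) = zero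
arcOf rA (suc (suc (suc zero))) = suc zero
arcOf rB zero = zero
arcOf rB (suc zero) = zero
arcOf rB (suc (suc zero)) = suc zero
arcOf rB (suc (suc (suc zero))) = suc zero
arcOf rP zero = zero
arcOf rP (suc zero) = suc zero
arcOf rP (suc (suc zero)) = zero
arcOf rP (suc (suc (suc zero))) = suc zero
arcOf rX _ = zero

-- vertices of a resolved diagram: graph vertices, and per crossing either one
-- 4-valent vertex (X) or one degree-2 vertex on each of the two arcs
-- (a subdivision of the arcs, which changes neither β₀, β₁ nor H)
SV : ℕ → ℕ → Set
SV nv nc = Fin nv ⊎ (Fin nc × Fin 2)

_≟SV_ : ∀ {nv nc} → DecidableEquality (SV nv nc)
_≟SV_ = SumP.≡-dec _≟F_ (ProdP.≡-dec _≟F_ _≟F_)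

module _ (D : Diagram) where
  resVerts : Vec Res (nc D) → List (SV (nv D) (nc D))
  resVerts rs = map inj₁ (allFin (nv D)) ++ concatMap crossVerts (allFin (nc D))
    where
    crossVerts : Fin (nc D) → List (SV (nv D) (nc D))
    crossVerts i with lookup rs i
    ... | rX = inj₂ (i , zero) ∷ []
    ... | _  = inj₂ (i , zero) ∷ inj₂ (i , suc zero) ∷ []

  resEnd : Vec Res (nc D) → End (nv D) (nc D) → SV (nv D) (nc D)
  resEnd rs (vert v)   = inj₁ v
  resEnd rs (slot i k) = inj₂ (i , arcOf (lookup rs i) k)

  resEdges : Vec Res (nc D) → List (SV (nv D) (nc D) × SV (nv D) (nc D))
  resEdges rs = map (λ e → resEnd rs (end D e zero) , resEnd rs (end D e (suc zero)))
                    (allFin (ne D))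


allVecs : {A : Set} → List A → (n : ℕ) → List (Vec A n)
allVecs xs zero    = [] ∷ []
allVecs xs (suc n) = concatMap (λ x → map (x ∷_) (allVecs xs n)) xs

count : Res → ∀ {n} → Vec Res n → ℕ
count r [] = 0
count r (s ∷ ss) with r | s
... | rA | rA = suc (count r ss)
... | rB | rB = suc (count r ss)
... | rX | rX = suc (count r ss)
... | rP | rP = suc (count r ss)
... | _  | _  = count r ss

crossings : Diagram → ℕ
crossings D = nc D

betti₁ : Diagram → ℕ
betti₁ D = GraphInv.β₁ (λ x y → _≟SV_ {nv D} {nc D} x y)
             (resVerts D (Data.Vec.replicate (nc D) rP))
             (resEdges D (Data.Vec.replicate (nc D) rP))

yamada : Diagram → Laurent
yamada D = sumL (map term (allVecs (rA ∷ rB ∷ rX ∷ []) (nc D)))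
  where
  term : Vec Res (nc D) → Laurent
  term s = mulL (monoA (ℤ.+ count rA s ℤ.- ℤ.+ count rB s))
                (GraphInv.H (λ x y → _≟SV_ {nv D} {nc D} x y) (resVerts D s) (resEdges D s))

module Submission where

-- A state S contributes A^(a(S) - b(S)) H(S), and the exponents of H(S) lie in [-β₁(S), β₁(S)]:
-- x = -A - 2 - A⁻¹ has exponents in [-1, 1], and β₁ does not grow on passing to a spanning
-- subgraph. So it suffices that a(S) + b(T) + β₁(S) + β₁(T) ≤ 3c + 2β₁(G) for any two states,
-- where c is the number of crossings. Let C be the set of crossings where S is A and T is B, and
-- σ_Y the state that is Y on C and X elsewhere. Replacing a smoothing by a 4-valent vertex
-- identifies two vertices, which never lowers β₁ and raises it by at most one; hence
-- β₁(S) ≤ β₁(σ_A), β₁(T) ≤ β₁(σ_B) and β₁(σ_P) ≤ β₁(G) + c - |C|. If the two strands at a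
-- crossing lie in one component of the P-resolution, then the two arcs do so in the A- or in the
-- B-resolution; so at each crossing of C one of the two smoothings has β₁ at most that of P, and
-- the other at most one more, giving β₁(σ_A) + β₁(σ_B) ≤ 2β₁(σ_P) + |C|. Finally
-- a(S) + b(T) ≤ c + |C|.


open import Defs
open import Data.Bool using (Bool; true; false; _∧_; _∨_; if_then_else_; not)
open import Data.Bool.Properties using (⇔→≡; ¬-not; ∨-assoc)
open import Data.Bool.ListAction using (any)
open import Data.Empty using (⊥; ⊥-elim)
open import Data.Nat as ℕ using (ℕ; zero; suc)
import Data.Nat.Properties as ℕP
open import Data.List using (List; []; _∷_; _++_; [_]; map; length; allFin; tabulate; concatMap)
open import Data.Fin using (Fin; zero; suc)
open import Data.Vec using (Vec; lookup; _[_]≔_)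
open import Data.Vec.Properties using (lookup∘update; lookup∘update′; []≔-lookup; tabulate∘lookup; tabulate-cong)
open import Data.Fin.Properties using () renaming (_≟_ to _≟ᶠ_)
open import Data.List.Properties using (++-assoc; map-++; length-map; length-++; map-tabulate)
open import Data.List.Membership.Propositional using (_∈_; _∉_)
open import Data.List.Membership.Propositional.Properties using (∈-++⁻; ∈-++⁺ˡ; ∈-++⁺ʳ; ∈-map⁻; ∈-map⁺; ∈-tabulate⁻)
open import Data.List.Relation.Unary.Any using (here; there)
open import Data.Product using (Σ; _×_; _,_; proj₁; proj₂; ∃-syntax)
open import Data.Sum using (_⊎_; inj₁; inj₂)
open import Function.Bundles using (mk⇔)
open import Relation.Nullary using (Dec; yes; no)
open import Relation.Binary.Definitions using (DecidableEquality)
open import Relation.Binary.Structures using (IsEquivalence)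
open import Relation.Binary.PropositionalEquality using (_≡_; _≢_; refl; sym; trans; cong; cong₂; subst; subst₂; module ≡-Reasoning)

bool-absurd : ∀ {b} → b ≡ true → b ≡ false → ⊥
bool-absurd refl ()

true-ext : ∀ {a b} → (a ≡ true → b ≡ true) → (b ≡ true → a ≡ true) → a ≡ b
true-ext f g = ⇔→≡ (mk⇔ f g)

∨-true⁻ : ∀ a {b} → a ∨ b ≡ true → a ≡ true ⊎ b ≡ true
∨-true⁻ true  _ = inj₁ refl
∨-true⁻ false p = inj₂ p

∨-trueˡ : ∀ {a} b → a ≡ true → a ∨ b ≡ true
∨-trueˡ _ refl = refl

∨-trueʳ : ∀ a {b} → b ≡ true → a ∨ b ≡ true
∨-trueʳ true  _ = refl
∨-trueʳ false p = p

∧-true⁻ : ∀ a {b} → a ∧ b ≡ true → a ≡ true × b ≡ true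
∧-true⁻ true p = refl , p

∧-true⁺ : ∀ {a b} → a ≡ true → b ≡ true → a ∧ b ≡ true
∧-true⁺ refl refl = refl

∨-exchange : ∀ a x l → a ∨ (x ∨ l) ≡ x ∨ (a ∨ l)
∨-exchange true  true  l = refl
∨-exchange true  false l = refl
∨-exchange false x     l = refl

module _ {A : Set} where

  any-witness : ∀ (f : A → Bool) l → any f l ≡ true → ∃[ x ] (x ∈ l × f x ≡ true)
  any-witness f (x ∷ l) p with ∨-true⁻ (f x) p
  ... | inj₁ fx = x , here refl , fx
  ... | inj₂ q  with any-witness f l q
  ... | y , y∈l , fy = y , there y∈l , fy

  any-intro : ∀ (f : A → Bool) {l x} → x ∈ l → f x ≡ true → any f l ≡ true
  any-intro f {_ ∷ l} (here refl) fx = ∨-trueˡ (any f l) fx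
  any-intro f {y ∷ _} (there x∈l) fx = ∨-trueʳ (f y) (any-intro f x∈l fx)

  any-mono : ∀ (f g : A → Bool) l → (∀ x → x ∈ l → f x ≡ true → g x ≡ true) →
             any f l ≡ true → any g l ≡ true
  any-mono f g l f⇒g p with any-witness f l p
  ... | x , x∈l , fx = any-intro g x∈l (f⇒g x x∈l fx)

  any-cong : ∀ (f g : A → Bool) l → (∀ x → f x ≡ g x) → any f l ≡ any g l
  any-cong f g []      f≗g = refl
  any-cong f g (x ∷ l) f≗g = cong₂ _∨_ (f≗g x) (any-cong f g l f≗g)

  any-map : ∀ (f : A → Bool) (φ : A → A) l → any f (map φ l) ≡ any (λ w → f (φ w)) l
  any-map f φ []      = refl
  any-map f φ (x ∷ l) = cong (f (φ x) ∨_) (any-map f φ l)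

  any-++ : ∀ (f : A → Bool) xs ys → any f (xs ++ ys) ≡ any f xs ∨ any f ys
  any-++ f []       ys = refl
  any-++ f (x ∷ xs) ys with f x
  ... | true  = refl
  ... | false = any-++ f xs ys

module Connectivity {V : Set} (_≟_ : DecidableEquality V) where

  open import Data.Nat using (_+_; _∸_; _≤_; _<_; z≤n; s≤s)

  open GraphInv _≟_ public

  module _ {A : Set} where

    countTrue : (A → Bool) → List A → ℕ
    countTrue f []      = 0
    countTrue f (x ∷ l) = if f x then suc (countTrue f l) else countTrue f l

    countTrue≤length : ∀ f l → countTrue f l ≤ length l
    countTrue≤length f []      = z≤n
    countTrue≤length f (x ∷ l) with f x
    ... | true  = s≤s (countTrue≤length f l)
    ... | false = ℕP.m≤n⇒m≤1+n (countTrue≤length f l)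

    countTrue-pos : ∀ f {l x} → x ∈ l → f x ≡ true → 1 ≤ countTrue f l
    countTrue-pos f (here refl) fx rewrite fx = s≤s z≤n
    countTrue-pos f {y ∷ _} (there x∈l) fx with f y
    ... | true  = s≤s z≤n
    ... | false = countTrue-pos f x∈l fx

    countTrue-mono : ∀ f g l → (∀ x → x ∈ l → f x ≡ true → g x ≡ true) →
                     countTrue f l ≤ countTrue g l
    countTrue-mono f g []      f⇒g = z≤n
    countTrue-mono f g (y ∷ l) f⇒g with f y in fy | g y in gy
    ... | true  | true  = s≤s (countTrue-mono f g l (λ x x∈l → f⇒g x (there x∈l)))
    ... | true  | false = ⊥-elim (bool-absurd (f⇒g y (here refl) fy) gy)
    ... | false | true  = ℕP.m≤n⇒m≤1+n (countTrue-mono f g l (λ x x∈l → f⇒g x (there x∈l)))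
    ... | false | false = countTrue-mono f g l (λ x x∈l → f⇒g x (there x∈l))

    countTrue-strict : ∀ f g l → (∀ x → x ∈ l → f x ≡ true → g x ≡ true) →
                       ∀ {x} → x ∈ l → g x ≡ true → f x ≡ false → countTrue f l < countTrue g l
    countTrue-strict f g (y ∷ l) f⇒g (here refl) gx fx rewrite gx | fx =
      s≤s (countTrue-mono f g l (λ z z∈l → f⇒g z (there z∈l)))
    countTrue-strict f g (y ∷ l) f⇒g (there x∈l) gx fx with f y in fy | g y in gy
    ... | true  | true  = s≤s (countTrue-strict f g l (λ z z∈l → f⇒g z (there z∈l)) x∈l gx fx)
    ... | true  | false = ⊥-elim (bool-absurd (f⇒g y (here refl) fy) gy)
    ... | false | true  = ℕP.m≤n⇒m≤1+n (countTrue-strict f g l (λ z z∈l → f⇒g z (there z∈l)) x∈l gx fx)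
    ... | false | false = countTrue-strict f g l (λ z z∈l → f⇒g z (there z∈l)) x∈l gx fx

    implies-or-counterexample : ∀ (f g : A → Bool) l →
      (∀ x → x ∈ l → g x ≡ true → f x ≡ true) ⊎ ∃[ x ] (x ∈ l × g x ≡ true × f x ≡ false)
    implies-or-counterexample f g [] = inj₁ (λ _ ())
    implies-or-counterexample f g (y ∷ l) with g y in gy | f y in fy | implies-or-counterexample f g l
    ... | _     | _     | inj₂ (x , x∈l , gx , fx) = inj₂ (x , there x∈l , gx , fx)
    ... | true  | false | inj₁ _   = inj₂ (y , here refl , gy , fy)
    ... | true  | true  | inj₁ g⇒f = inj₁ λ { x (here refl) _ → fy ; x (there x∈l) → g⇒f x x∈l }
    ... | false | _     | inj₁ g⇒f = inj₁ λ { x (here refl) gx → ⊥-elim (bool-absurd gx gy) ; x (there x∈l) → g⇒f x x∈l }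

  Edge : Set
  Edge = V × V

  eqb-refl : ∀ u → eqb u u ≡ true
  eqb-refl u with u ≟ u
  ... | yes _  = refl
  ... | no u≢u = ⊥-elim (u≢u refl)

  eqb⇒≡ : ∀ {u v} → eqb u v ≡ true → u ≡ v
  eqb⇒≡ {u} {v} p with u ≟ v
  ... | yes u≡v = u≡v

  ≢⇒eqb-false : ∀ {u v} → u ≢ v → eqb u v ≡ false
  ≢⇒eqb-false {u} {v} u≢v with u ≟ v
  ... | yes u≡v = ⊥-elim (u≢v u≡v)
  ... | no _    = refl

  Joins : Edge → V → V → Set
  Joins e w v = (proj₁ e ≡ w × proj₂ e ≡ v) ⊎ (proj₁ e ≡ v × proj₂ e ≡ w)

  Joins-sym : ∀ {e w v} → Joins e w v → Joins e v w
  Joins-sym (inj₁ ends) = inj₂ ends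
  Joins-sym (inj₂ ends) = inj₁ ends

  adj⇒Joins : ∀ es w v → adj es w v ≡ true → ∃[ e ] (e ∈ es × Joins e w v)
  adj⇒Joins es w v p with any-witness _ es p
  ... | e , e∈es , q with ∨-true⁻ (eqb (proj₁ e) w ∧ eqb (proj₂ e) v) q
  ... | inj₁ r = e , e∈es , inj₁ (eqb⇒≡ (proj₁ (∧-true⁻ _ r)) , eqb⇒≡ (proj₂ (∧-true⁻ _ r)))
  ... | inj₂ r = e , e∈es , inj₂ (eqb⇒≡ (proj₁ (∧-true⁻ _ r)) , eqb⇒≡ (proj₂ (∧-true⁻ _ r)))

  Joins⇒adj : ∀ es {e w v} → e ∈ es → Joins e w v → adj es w v ≡ true
  Joins⇒adj es {e} e∈es (inj₁ (refl , refl)) =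
    any-intro _ e∈es (∨-trueˡ _ (∧-true⁺ (eqb-refl (proj₁ e)) (eqb-refl (proj₂ e))))
  Joins⇒adj es {e} e∈es (inj₂ (refl , refl)) =
    any-intro _ e∈es (∨-trueʳ _ (∧-true⁺ (eqb-refl (proj₁ e)) (eqb-refl (proj₂ e))))

  adj-sym : ∀ es {w v} → adj es w v ≡ true → adj es v w ≡ true
  adj-sym es {w} {v} p with adj⇒Joins es w v p
  ... | e , e∈es , j = Joins⇒adj es e∈es (Joins-sym j)

  EdgesWithin : List V → List Edge → Set
  EdgesWithin vs es = ∀ {e} → e ∈ es → proj₁ e ∈ vs × proj₂ e ∈ vs

  EdgesWithin-∷ : ∀ {vs es p q} → EdgesWithin vs es → p ∈ vs → q ∈ vs →
                  EdgesWithin vs ((p , q) ∷ es)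
  EdgesWithin-∷ within p∈vs q∈vs (here refl) = p∈vs , q∈vs
  EdgesWithin-∷ within p∈vs q∈vs (there e∈es) = within e∈es

  adj⇒∈ : ∀ {vs es} → EdgesWithin vs es → ∀ {w v} → adj es w v ≡ true → w ∈ vs × v ∈ vs
  adj⇒∈ within {w} {v} p with adj⇒Joins _ w v p
  ... | e , e∈es , inj₁ (refl , refl) = within e∈es
  ... | e , e∈es , inj₂ (refl , refl) = proj₂ (within e∈es) , proj₁ (within e∈es)

  module Walks (vs : List V) (es : List Edge) where

    reach-inv : ∀ k {u v} → reach vs es (suc k) u v ≡ true →
                reach vs es k u v ≡ true ⊎
                ∃[ w ] (w ∈ vs × reach vs es k u w ≡ true × adj es w v ≡ true)
    reach-inv k {u} {v} p with ∨-true⁻ (reach vs es k u v) p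
    ... | inj₁ q = inj₁ q
    ... | inj₂ q with any-witness _ vs q
    ... | w , w∈vs , s = inj₂ (w , w∈vs , ∧-true⁻ _ s)

    reach-suc : ∀ k {u v} → reach vs es k u v ≡ true → reach vs es (suc k) u v ≡ true
    reach-suc k p = ∨-trueˡ _ p

    reach-+ : ∀ m k {u v} → reach vs es k u v ≡ true → reach vs es (m + k) u v ≡ true
    reach-+ zero    k p = p
    reach-+ (suc m) k p = reach-suc (m + k) (reach-+ m k p)

    reach-step : ∀ k {u w v} → reach vs es k u w ≡ true → w ∈ vs → adj es w v ≡ true →
                 reach vs es (suc k) u v ≡ true
    reach-step k {u} {w} {v} p w∈vs a = ∨-trueʳ (reach vs es k u v) (any-intro _ w∈vs (∧-true⁺ p a))

    reach-trans : ∀ k {j u w v} → reach vs es j u w ≡ true → reach vs es k w v ≡ true →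
                  reach vs es (k + j) u v ≡ true
    reach-trans zero    p q with eqb⇒≡ q
    ... | refl = p
    reach-trans (suc k) {j} p q with reach-inv k q
    ... | inj₁ q′                  = reach-suc (k + j) (reach-trans k p q′)
    ... | inj₂ (w , w∈vs , q′ , a) = reach-step (k + j) (reach-trans k p q′) w∈vs a

    Walk : V → V → Set
    Walk u v = ∃[ k ] (reach vs es k u v ≡ true)

    walk-refl : ∀ u → Walk u u
    walk-refl u = 0 , eqb-refl u

    walk-trans : ∀ {u w v} → Walk u w → Walk w v → Walk u v
    walk-trans (j , p) (k , q) = k + j , reach-trans k p q

    module _ (within : EdgesWithin vs es) where

      reach⇒≡⊎∈ : ∀ k {u v} → reach vs es k u v ≡ true → u ≡ v ⊎ (u ∈ vs × v ∈ vs)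
      reach⇒≡⊎∈ zero    p = inj₁ (eqb⇒≡ p)
      reach⇒≡⊎∈ (suc k) p with reach-inv k p
      ... | inj₁ q = reach⇒≡⊎∈ k q
      ... | inj₂ (w , w∈vs , q , a) with reach⇒≡⊎∈ k q
      ... | inj₁ refl        = inj₂ (w∈vs , proj₂ (adj⇒∈ within a))
      ... | inj₂ (u∈vs , _) = inj₂ (u∈vs , proj₂ (adj⇒∈ within a))

      reach⇒walk-sym : ∀ k {u v} → reach vs es k u v ≡ true → Walk v u
      reach⇒walk-sym zero p with eqb⇒≡ p
      ... | refl = walk-refl _
      reach⇒walk-sym (suc k) p with reach-inv k p
      ... | inj₁ q = reach⇒walk-sym k q
      ... | inj₂ (w , w∈vs , q , a) =
        walk-trans (1 , reach-step 0 (eqb-refl _) (proj₂ (adj⇒∈ within a)) (adj-sym es a))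
                   (reach⇒walk-sym k q)

      walk-sym : ∀ {u v} → Walk u v → Walk v u
      walk-sym (k , p) = reach⇒walk-sym k p

      -- The vertices reached from u within k steps form an increasing sequence of subsets
      -- of vs, so it is constant from step |vs| on.
      module Saturation (u : V) (u∈vs : u ∈ vs) where

        Stable : ℕ → Set
        Stable k = ∀ v → reach vs es (suc k) u v ≡ true → reach vs es k u v ≡ true

        stable-suc : ∀ k → (∀ w → w ∈ vs → reach vs es (suc k) u w ≡ true → reach vs es k u w ≡ true) →
                     Stable (suc k)
        stable-suc k stable v p with reach-inv (suc k) p
        ... | inj₁ q                  = q
        ... | inj₂ (w , w∈vs , q , a) = reach-step k (stable w w∈vs q) w∈vs a

        stable-or-growing : ∀ k → Stable k ⊎ suc k ≤ countTrue (reach vs es k u) vs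
        stable-or-growing zero = inj₂ (countTrue-pos _ u∈vs (eqb-refl u))
        stable-or-growing (suc k) with stable-or-growing k
        ... | inj₁ stable = inj₁ (stable-suc k (λ w _ → stable w))
        ... | inj₂ growing with implies-or-counterexample (reach vs es k u) (reach vs es (suc k) u) vs
        ... | inj₁ stable = inj₁ (stable-suc k stable)
        ... | inj₂ (x , x∈vs , new , old) =
          inj₂ (ℕP.≤-trans (s≤s growing)
                  (countTrue-strict _ _ vs (λ _ _ → reach-suc k) x∈vs new old))

        stable-length : Stable (length vs)
        stable-length with stable-or-growing (length vs)
        ... | inj₁ stable  = stable
        ... | inj₂ growing = ⊥-elim (ℕP.<-irrefl refl (ℕP.≤-trans growing (countTrue≤length _ vs)))

        stable-beyond : ∀ m → Stable (m + length vs)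
        stable-beyond zero    = stable-length
        stable-beyond (suc m) = stable-suc (m + length vs) (λ w _ → stable-beyond m w)

        reach-saturated : ∀ m {v} → reach vs es (m + length vs) u v ≡ true → connected vs es u v ≡ true
        reach-saturated zero    p = p
        reach-saturated (suc m) p = reach-saturated m (stable-beyond m _ p)

      walk⇒connected : ∀ {u v} → Walk u v → connected vs es u v ≡ true
      walk⇒connected {u} {v} (k , p) with reach⇒≡⊎∈ k p
      ... | inj₁ refl =
        subst (λ n → reach vs es n u u ≡ true) (ℕP.+-identityʳ (length vs)) (reach-+ (length vs) 0 (eqb-refl u))
      ... | inj₂ (u∈vs , _) =
        Saturation.reach-saturated u u∈vs k
          (subst (λ n → reach vs es n u v ≡ true) (ℕP.+-comm (length vs) k) (reach-+ (length vs) k p))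

  module Connected {vs : List V} {es : List Edge} (within : EdgesWithin vs es) where

    open Walks vs es

    Connected : V → V → Set
    Connected u v = connected vs es u v ≡ true

    connected-refl : ∀ u → Connected u u
    connected-refl u = walk⇒connected within (walk-refl u)

    connected-sym : ∀ {u v} → Connected u v → Connected v u
    connected-sym p = walk⇒connected within (walk-sym within (length vs , p))

    connected-trans : ∀ {u w v} → Connected u w → Connected w v → Connected u v
    connected-trans p q = walk⇒connected within (walk-trans (length vs , p) (length vs , q))

    adj⇒connected : ∀ {u v} → adj es u v ≡ true → Connected u v
    adj⇒connected a = walk⇒connected within (1 , reach-step 0 (eqb-refl _) (proj₁ (adj⇒∈ within a)) a)

    connected-isEquivalence : IsEquivalence Connected
    connected-isEquivalence = record { refl = connected-refl _ ; sym = connected-sym ; trans = connected-trans }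

    connected-ind : (Q : V → V → Set) → (∀ u → Q u u) →
                    (∀ {u w v} → Q u w → w ∈ vs → adj es w v ≡ true → Q u v) →
                    ∀ {u v} → Connected u v → Q u v
    connected-ind Q base step {u} = go (length vs)
      where
      go : ∀ k {v} → reach vs es k u v ≡ true → Q u v
      go zero p with eqb⇒≡ p
      ... | refl = base u
      go (suc k) p with reach-inv k p
      ... | inj₁ q                  = go k q
      ... | inj₂ (w , w∈vs , q , a) = step (go k q) w∈vs a

  -- comps with the relation abstracted, so that it can be compared across graphs
  newClasses : (V → V → Bool) → List V → List V → ℕ
  newClasses R seen []      = 0
  newClasses R seen (v ∷ l) =
    if any (λ w → R w v) seen then newClasses R (v ∷ seen) l else suc (newClasses R (v ∷ seen) l)

  comps≡newClasses : ∀ vs es seen l → comps vs es seen l ≡ newClasses (connected vs es) seen l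
  comps≡newClasses vs es seen []      = refl
  comps≡newClasses vs es seen (v ∷ l) =
    cong (λ n → if any (λ w → connected vs es w v) seen then n else suc n) (comps≡newClasses vs es (v ∷ seen) l)

  β₀≡newClasses : ∀ vs es → β₀ vs es ≡ newClasses (connected vs es) [] vs
  β₀≡newClasses vs es = comps≡newClasses vs es [] vs

  newClasses-cong : ∀ R R′ seen seen′ l →
    (∀ v → v ∈ l → any (λ w → R w v) seen ≡ any (λ w → R′ w v) seen′) →
    (∀ w v → w ∈ l → v ∈ l → R w v ≡ R′ w v) →
    newClasses R seen l ≡ newClasses R′ seen′ l
  newClasses-cong R R′ seen seen′ []      _       _     = refl
  newClasses-cong R R′ seen seen′ (v ∷ l) seen≗ R≗R′ rewrite seen≗ v (here refl) =
    cong (λ n → if any (λ w → R′ w v) seen′ then n else suc n)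
         (newClasses-cong R R′ (v ∷ seen) (v ∷ seen′) l seen≗′ R≗R′′)
    where
    R≗R′′ : ∀ w u → w ∈ l → u ∈ l → R w u ≡ R′ w u
    R≗R′′ w u w∈l u∈l = R≗R′ w u (there w∈l) (there u∈l)
    seen≗′ : ∀ u → u ∈ l → any (λ w → R w u) (v ∷ seen) ≡ any (λ w → R′ w u) (v ∷ seen′)
    seen≗′ u u∈l = cong₂ _∨_ (R≗R′ v u (here refl) (there u∈l)) (seen≗ u (there u∈l))

  newClasses-map : ∀ (φ : V → V) R seen l →
    newClasses (λ a b → R (φ a) (φ b)) seen l ≡ newClasses R (map φ seen) (map φ l)
  newClasses-map φ R seen []      = refl
  newClasses-map φ R seen (v ∷ l) rewrite any-map (λ w → R w (φ v)) φ seen =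
    cong (λ n → if any (λ w → R (φ w) (φ v)) seen then n else suc n) (newClasses-map φ R (v ∷ seen) l)

  newClasses-dup : ∀ R x → R x x ≡ true → ∀ P Q seen →
    newClasses R seen (P ++ x ∷ x ∷ Q) ≡ newClasses R seen (P ++ x ∷ Q)
  newClasses-dup R x Rxx [] Q seen =
    cong (λ n → if any (λ w → R w x) seen then n else suc n)
      (trans skip-x (newClasses-cong R R (x ∷ x ∷ seen) (x ∷ seen) Q (λ v _ → any-dup v) (λ _ _ _ _ → refl)))
    where
    skip-x : newClasses R (x ∷ seen) (x ∷ Q) ≡ newClasses R (x ∷ x ∷ seen) Q
    skip-x rewrite Rxx = refl
    any-dup : ∀ v → any (λ w → R w v) (x ∷ x ∷ seen) ≡ any (λ w → R w v) (x ∷ seen)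
    any-dup v with R x v
    ... | true  = refl
    ... | false = refl
  newClasses-dup R x Rxx (y ∷ P) Q seen =
    cong (λ n → if any (λ w → R w y) seen then n else suc n) (newClasses-dup R x Rxx P Q (y ∷ seen))

  ∨-rotate : ∀ x a l → a ∨ (x ∨ l) ≡ true → (x ∨ a) ∨ l ≡ true
  ∨-rotate x a l p = trans (∨-assoc x a l) (trans (∨-exchange x a l) p)

  module Join (R : V → V → Bool) (isEquiv : IsEquivalence (λ u v → R u v ≡ true)) (p q : V) where

    open IsEquivalence isEquiv renaming (refl to R-refl; sym to R-sym; trans to R-trans)

    Rpq : V → V → Bool
    Rpq w v = R w v ∨ ((R w p ∧ R v q) ∨ (R w q ∧ R v p))

    Rpq-cases : ∀ {w v} → Rpq w v ≡ true →
      R w v ≡ true ⊎ ((R w p ≡ true × R v q ≡ true) ⊎ (R w q ≡ true × R v p ≡ true))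
    Rpq-cases {w} {v} h with ∨-true⁻ (R w v) h
    ... | inj₁ wv = inj₁ wv
    ... | inj₂ h′ with ∨-true⁻ (R w p ∧ R v q) h′
    ... | inj₁ wp∧vq = inj₂ (inj₁ (∧-true⁻ _ wp∧vq))
    ... | inj₂ wq∧vp = inj₂ (inj₂ (∧-true⁻ _ wq∧vp))

    R⇒Rpq : ∀ {w v} → R w v ≡ true → Rpq w v ≡ true
    R⇒Rpq {w} {v} = ∨-trueˡ ((R w p ∧ R v q) ∨ (R w q ∧ R v p))

    Rpq-via-p : ∀ {w v} → R w p ≡ true → R v q ≡ true → Rpq w v ≡ true
    Rpq-via-p {w} {v} wp vq = ∨-trueʳ (R w v) (∨-trueˡ (R w q ∧ R v p) (∧-true⁺ wp vq))

    Rpq-via-q : ∀ {w v} → R w q ≡ true → R v p ≡ true → Rpq w v ≡ true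
    Rpq-via-q {w} {v} wq vp = ∨-trueʳ (R w v) (∨-trueʳ (R w p ∧ R v q) (∧-true⁺ wq vp))

    Rpq-extend : ∀ {u w v} → Rpq u w ≡ true → R w v ≡ true → Rpq u v ≡ true
    Rpq-extend uw wv with Rpq-cases uw
    ... | inj₁ uw′             = R⇒Rpq (R-trans uw′ wv)
    ... | inj₂ (inj₁ (up , wq)) = Rpq-via-p up (R-trans (R-sym wv) wq)
    ... | inj₂ (inj₂ (uq , wp)) = Rpq-via-q uq (R-trans (R-sym wv) wp)

    Rpq-p⇒q : ∀ {u} → Rpq u p ≡ true → Rpq u q ≡ true
    Rpq-p⇒q up with Rpq-cases up
    ... | inj₁ up′             = Rpq-via-p up′ R-refl
    ... | inj₂ (inj₁ (up′ , _)) = Rpq-via-p up′ R-refl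
    ... | inj₂ (inj₂ (uq , _))  = R⇒Rpq uq

    Rpq-q⇒p : ∀ {u} → Rpq u q ≡ true → Rpq u p ≡ true
    Rpq-q⇒p uq with Rpq-cases uq
    ... | inj₁ uq′             = Rpq-via-q uq′ R-refl
    ... | inj₂ (inj₁ (up , _))  = R⇒Rpq up
    ... | inj₂ (inj₂ (uq′ , _)) = Rpq-via-q uq′ R-refl

    newClasses-related : R p q ≡ true → ∀ seen l → newClasses R seen l ≡ newClasses Rpq seen l
    newClasses-related pq seen l =
      newClasses-cong R Rpq seen seen l
        (λ v _ → true-ext (any-mono _ _ seen (λ _ _ → R⇒Rpq)) (any-mono _ _ seen (λ _ _ → Rpq⇒R)))
        (λ w v _ _ → true-ext R⇒Rpq Rpq⇒R)
      where
      Rpq⇒R : ∀ {w v} → Rpq w v ≡ true → R w v ≡ true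
      Rpq⇒R h with Rpq-cases h
      ... | inj₁ wv                = wv
      ... | inj₂ (inj₁ (wp , vq)) = R-trans wp (R-trans pq (R-sym vq))
      ... | inj₂ (inj₂ (wq , vp)) = R-trans wq (R-trans (R-sym pq) (R-sym vp))

    meetsP meetsQ : List V → Bool
    meetsP seen = any (λ w → R w p) seen
    meetsQ seen = any (λ w → R w q) seen

    any-R≡any-Rpq : ∀ seen v → meetsP seen ≡ true → meetsQ seen ≡ true →
                    any (λ w → R w v) seen ≡ any (λ w → Rpq w v) seen
    any-R≡any-Rpq seen v mp mq = true-ext (any-mono _ _ seen (λ _ _ → R⇒Rpq)) Rpq⇒R
      where
      Rpq⇒R : any (λ w → Rpq w v) seen ≡ true → any (λ w → R w v) seen ≡ true
      Rpq⇒R h with any-witness _ seen h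
      ... | w , w∈seen , wv with Rpq-cases wv
      ... | inj₁ wv′ = any-intro _ w∈seen wv′
      ... | inj₂ (inj₁ (_ , vq)) with any-witness _ seen mq
      ... | w′ , w′∈seen , w′q = any-intro _ w′∈seen (R-trans w′q (R-sym vq))
      Rpq⇒R h | w , w∈seen , wv | inj₂ (inj₂ (_ , vp)) with any-witness _ seen mp
      ... | w′ , w′∈seen , w′p = any-intro _ w′∈seen (R-trans w′p (R-sym vp))

    newClasses-met : ∀ seen l → meetsP seen ≡ true → meetsQ seen ≡ true →
                     newClasses R seen l ≡ newClasses Rpq seen l
    newClasses-met seen []      mp mq = refl
    newClasses-met seen (v ∷ l) mp mq rewrite any-R≡any-Rpq seen v mp mq
      with any (λ w → Rpq w v) seen
    ... | true  = newClasses-met (v ∷ seen) l (∨-trueʳ (R v p) mp) (∨-trueʳ (R v q) mq)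
    ... | false = cong suc (newClasses-met (v ∷ seen) l (∨-trueʳ (R v p) mp) (∨-trueʳ (R v q) mq))

    unmet-∷-new : ∀ {seen v} → R p q ≡ false → any (λ w → Rpq w v) seen ≡ false →
                  (meetsP seen ≡ true → meetsQ seen ≡ true → ⊥) →
                  meetsP (v ∷ seen) ≡ true → meetsQ (v ∷ seen) ≡ true → ⊥
    unmet-∷-new {seen} {v} ¬pq new unmet mp mq with ∨-true⁻ (R v p) mp | ∨-true⁻ (R v q) mq
    ... | inj₁ vp | inj₁ vq = bool-absurd (R-trans (R-sym vp) vq) ¬pq
    ... | inj₁ vp | inj₂ mq′ with any-witness _ seen mq′
    ...   | w , w∈seen , wq = bool-absurd (any-intro (λ w → Rpq w v) w∈seen (Rpq-via-q wq vp)) new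
    unmet-∷-new {seen} {v} ¬pq new unmet mp mq | inj₂ mp′ | inj₁ vq with any-witness _ seen mp′
    ...   | w , w∈seen , wp = bool-absurd (any-intro (λ w → Rpq w v) w∈seen (Rpq-via-p wp vq)) new
    unmet-∷-new ¬pq new unmet mp mq | inj₂ mp′ | inj₂ mq′ = unmet mp′ mq′

    -- Scanning l, the first element of the joined class is counted on both sides; the first
    -- element of the other of the two R-classes is counted only on the left.
    newClasses-separated : R p q ≡ false → ∀ seen l →
      (meetsP seen ≡ true → meetsQ seen ≡ true → ⊥) →
      meetsP seen ∨ meetsP l ≡ true → meetsQ seen ∨ meetsQ l ≡ true →
      newClasses R seen l ≡ suc (newClasses Rpq seen l)
    newClasses-separated ¬pq seen [] unmet mp mq with ∨-true⁻ (meetsP seen) mp | ∨-true⁻ (meetsQ seen) mq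
    ... | inj₁ mp′ | inj₁ mq′ = ⊥-elim (unmet mp′ mq′)
    newClasses-separated ¬pq seen (v ∷ l) unmet mp mq
      with any (λ w → R w v) seen in old | any (λ w → Rpq w v) seen in old⁺
    ... | true  | false = ⊥-elim (bool-absurd (any-mono _ _ seen (λ _ _ → R⇒Rpq) old) old⁺)
    ... | true  | true  =
      newClasses-separated ¬pq (v ∷ seen) l unmet′ (∨-rotate (R v p) (meetsP seen) (meetsP l) mp)
                                                   (∨-rotate (R v q) (meetsQ seen) (meetsQ l) mq)
      where
      seen-absorbs : ∀ {x} → any (λ w → R w x) (v ∷ seen) ≡ true → any (λ w → R w x) seen ≡ true
      seen-absorbs {x} h with ∨-true⁻ (R v x) h | any-witness _ seen old
      ... | inj₁ vx    | w , w∈seen , wv = any-intro _ w∈seen (R-trans wv vx)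
      ... | inj₂ seenx | _               = seenx
      unmet′ : meetsP (v ∷ seen) ≡ true → meetsQ (v ∷ seen) ≡ true → ⊥
      unmet′ mp′ mq′ = unmet (seen-absorbs mp′) (seen-absorbs mq′)
    ... | false | false =
      cong suc (newClasses-separated ¬pq (v ∷ seen) l (unmet-∷-new {seen} {v} ¬pq old⁺ unmet)
                 (∨-rotate (R v p) (meetsP seen) (meetsP l) mp) (∨-rotate (R v q) (meetsQ seen) (meetsQ l) mq))
    ... | false | true = cong suc (newClasses-met (v ∷ seen) l (proj₁ bridged) (proj₂ bridged))
      where
      bridged : meetsP (v ∷ seen) ≡ true × meetsQ (v ∷ seen) ≡ true
      bridged with any-witness _ seen old⁺
      ... | w , w∈seen , wv with Rpq-cases wv
      ... | inj₁ wv′             = ⊥-elim (bool-absurd (any-intro _ w∈seen wv′) old)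
      ... | inj₂ (inj₁ (wp , vq)) = ∨-trueʳ (R v p) (any-intro _ w∈seen wp) , ∨-trueˡ (meetsQ seen) vq
      ... | inj₂ (inj₂ (wq , vp)) = ∨-trueˡ (meetsP seen) vp , ∨-trueʳ (R v q) (any-intro _ w∈seen wq)

  module AddEdge {vs : List V} {es : List Edge} (within : EdgesWithin vs es)
                 {p q : V} (p∈vs : p ∈ vs) (q∈vs : q ∈ vs) where

    private
      es⁺ : List Edge
      es⁺ = (p , q) ∷ es

      module C  = Connected within
      module C⁺ = Connected (EdgesWithin-∷ within p∈vs q∈vs)

    open Join (connected vs es) C.connected-isEquivalence p q

    private
      connected⁺⇒Rpq : ∀ {w v} → connected vs es⁺ w v ≡ true → Rpq w v ≡ true
      connected⁺⇒Rpq = C⁺.connected-ind (λ w v → Rpq w v ≡ true) (λ u → R⇒Rpq (C.connected-refl u)) step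
        where
        step : ∀ {u w v} → Rpq u w ≡ true → w ∈ vs → adj es⁺ w v ≡ true → Rpq u v ≡ true
        step {u} {w} {v} uw _ a with adj⇒Joins es⁺ w v a
        ... | e , there e∈es , j                  = Rpq-extend uw (C.adj⇒connected (Joins⇒adj es e∈es j))
        ... | e , here refl , inj₁ (refl , refl) = Rpq-p⇒q uw
        ... | e , here refl , inj₂ (refl , refl) = Rpq-q⇒p uw

      connected⇒connected⁺ : ∀ {w v} → connected vs es w v ≡ true → connected vs es⁺ w v ≡ true
      connected⇒connected⁺ = C.connected-ind (λ w v → connected vs es⁺ w v ≡ true) C⁺.connected-refl
        (λ uw _ a → C⁺.connected-trans uw (C⁺.adj⇒connected (∨-trueʳ _ a)))

      pq⁺ : connected vs es⁺ p q ≡ true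
      pq⁺ = C⁺.adj⇒connected (Joins⇒adj es⁺ (here refl) (inj₁ (refl , refl)))

      Rpq⇒connected⁺ : ∀ {w v} → Rpq w v ≡ true → connected vs es⁺ w v ≡ true
      Rpq⇒connected⁺ h with Rpq-cases h
      ... | inj₁ wv = connected⇒connected⁺ wv
      ... | inj₂ (inj₁ (wp , vq)) =
        C⁺.connected-trans (connected⇒connected⁺ wp) (C⁺.connected-trans pq⁺ (C⁺.connected-sym (connected⇒connected⁺ vq)))
      ... | inj₂ (inj₂ (wq , vp)) =
        C⁺.connected-trans (connected⇒connected⁺ wq)
          (C⁺.connected-trans (C⁺.connected-sym pq⁺) (C⁺.connected-sym (connected⇒connected⁺ vp)))

      β₀⁺≡newClasses-Rpq : β₀ vs es⁺ ≡ newClasses Rpq [] vs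
      β₀⁺≡newClasses-Rpq = trans (β₀≡newClasses vs es⁺)
        (newClasses-cong _ _ [] [] vs (λ _ _ → refl) (λ _ _ _ _ → true-ext connected⁺⇒Rpq Rpq⇒connected⁺))

    β₀-add-related : connected vs es p q ≡ true → β₀ vs es ≡ β₀ vs es⁺
    β₀-add-related pq = trans (β₀≡newClasses vs es) (trans (newClasses-related pq [] vs) (sym β₀⁺≡newClasses-Rpq))

    β₀-add-separated : connected vs es p q ≡ false → β₀ vs es ≡ suc (β₀ vs es⁺)
    β₀-add-separated ¬pq =
      trans (β₀≡newClasses vs es)
        (trans (newClasses-separated ¬pq [] vs (λ ()) (any-intro _ p∈vs (C.connected-refl p))
                                               (any-intro _ q∈vs (C.connected-refl q)))
               (cong suc (sym β₀⁺≡newClasses-Rpq)))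

    β₀-add-≤ : β₀ vs es ≤ suc (β₀ vs es⁺)
    β₀-add-≤ with connected vs es p q in pq
    ... | true  = ℕP.≤-trans (ℕP.≤-reflexive (β₀-add-related pq)) (ℕP.n≤1+n _)
    ... | false = ℕP.≤-reflexive (β₀-add-separated pq)

  reach-cong : ∀ vs es es′ → (∀ w v → adj es w v ≡ adj es′ w v) →
               ∀ k u v → reach vs es k u v ≡ reach vs es′ k u v
  reach-cong vs es es′ adj≗ zero    u v = refl
  reach-cong vs es es′ adj≗ (suc k) u v =
    cong₂ _∨_ (reach-cong vs es es′ adj≗ k u v)
              (any-cong _ _ vs (λ w → cong₂ _∧_ (reach-cong vs es es′ adj≗ k u w) (adj≗ w v)))

  β₀-cong : ∀ vs es es′ → (∀ w v → adj es w v ≡ adj es′ w v) → β₀ vs es ≡ β₀ vs es′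
  β₀-cong vs es es′ adj≗ = trans (β₀≡newClasses vs es) (trans
    (newClasses-cong _ _ [] [] vs (λ _ _ → refl) (λ w v _ _ → reach-cong vs es es′ adj≗ (length vs) w v))
    (sym (β₀≡newClasses vs es′)))

  adj-middle : ∀ B e es w v → adj (B ++ e ∷ es) w v ≡ adj (e ∷ B ++ es) w v
  adj-middle B e es w v = begin
    any f (B ++ e ∷ es)          ≡⟨ any-++ f B (e ∷ es) ⟩
    any f B ∨ (f e ∨ any f es)   ≡⟨ ∨-exchange (any f B) (f e) (any f es) ⟩
    f e ∨ (any f B ∨ any f es)   ≡⟨ cong (f e ∨_) (sym (any-++ f B es)) ⟩
    f e ∨ any f (B ++ es)        ∎
    where
    open ≡-Reasoning
    f : Edge → Bool
    f e = (eqb (proj₁ e) w ∧ eqb (proj₂ e) v) ∨ (eqb (proj₁ e) v ∧ eqb (proj₂ e) w)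

  ∈-++-middle : ∀ {A : Set} (B : List A) {e es x} → x ∈ B ++ es → x ∈ B ++ e ∷ es
  ∈-++-middle B x∈ with ∈-++⁻ B x∈
  ... | inj₁ x∈B  = ∈-++⁺ˡ x∈B
  ... | inj₂ x∈es = ∈-++⁺ʳ B (there x∈es)

  -- Generalised over the prefix B of edges kept in both graphs, so that the induction on es
  -- can move a kept edge into B.
  nullity-sublist : ∀ vs B es K → K ∈ sublists es → EdgesWithin vs (B ++ es) →
                    length K + β₀ vs (B ++ K) ≤ length es + β₀ vs (B ++ es)
  nullity-sublist vs B []       .[] (here refl) within = ℕP.≤-refl
  nullity-sublist vs B (e ∷ es) K   K∈        within with ∈-++⁻ (sublists es) K∈
  ... | inj₁ K∈es = begin
    length K + β₀ vs (B ++ K)               ≤⟨ nullity-sublist vs B es K K∈es within′ ⟩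
    length es + β₀ vs (B ++ es)             ≤⟨ ℕP.+-monoʳ-≤ (length es) (AddEdge.β₀-add-≤ within′ e₁∈ e₂∈) ⟩
    length es + suc (β₀ vs (e ∷ B ++ es))   ≡⟨ ℕP.+-suc (length es) _ ⟩
    suc (length es + β₀ vs (e ∷ B ++ es))   ≡⟨ cong (λ n → suc (length es + n)) (β₀-cong vs _ _ (λ w v → sym (adj-middle B e es w v))) ⟩
    suc (length es + β₀ vs (B ++ e ∷ es))   ∎
    where
    open ℕP.≤-Reasoning
    within′ : EdgesWithin vs (B ++ es)
    within′ x∈ = within (∈-++-middle B x∈)
    e₁∈ = proj₁ (within (∈-++⁺ʳ B (here refl)))
    e₂∈ = proj₂ (within (∈-++⁺ʳ B (here refl)))
  ... | inj₂ K∈e∷ with ∈-map⁻ (e ∷_) K∈e∷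
  ... | K′ , K′∈es , refl = s≤s (subst₂ (λ E F → length K′ + β₀ vs E ≤ length es + β₀ vs F)
                                       (++-assoc B [ e ] K′) (++-assoc B [ e ] es)
                                       (nullity-sublist vs (B ++ [ e ]) es K′ K′∈es within′))
    where
    within′ : EdgesWithin vs ((B ++ [ e ]) ++ es)
    within′ = subst (EdgesWithin vs) (sym (++-assoc B [ e ] es)) within

  β₁-sublist : ∀ vs es K → K ∈ sublists es → EdgesWithin vs es → β₁ vs K ≤ β₁ vs es
  β₁-sublist vs es K K∈ within = ℕP.∸-monoˡ-≤ (length vs) (nullity-sublist vs [] es K K∈ within)

  replace : V → V → V → V
  replace q p w with w ≟ q
  ... | yes _ = p
  ... | no _  = w

  replace-hit : ∀ q p → replace q p q ≡ p
  replace-hit q p with q ≟ q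
  ... | yes _  = refl
  ... | no q≢q = ⊥-elim (q≢q refl)

  replace-miss : ∀ {q p w} → w ≢ q → replace q p w ≡ w
  replace-miss {q} {p} {w} w≢q with w ≟ q
  ... | yes w≡q = ⊥-elim (w≢q w≡q)
  ... | no _    = refl

  replace² : V → V → Edge → Edge
  replace² q p (w , v) = replace q p w , replace q p v

  module Identify (P Q : List V) {p q : V} (p≢q : p ≢ q) (q∉P : q ∉ P) (q∉Q : q ∉ Q)
                  {es : List Edge} (within : EdgesWithin (P ++ p ∷ q ∷ Q) es) where

    vs vs/ : List V
    vs  = P ++ p ∷ q ∷ Q
    vs/ = P ++ p ∷ Q

    es⁺ es/ : List Edge
    es⁺ = (p , q) ∷ es
    es/ = map (replace² q p) es

    private
      φ : V → V
      φ = replace q p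

      replace-∈ : ∀ {x} → x ∈ vs → φ x ∈ vs/
      replace-∈ {x} x∈ with x ≟ q
      ... | yes _ = ∈-++⁺ʳ P (here refl)
      ... | no x≢q with ∈-++⁻ P x∈
      ...   | inj₁ x∈P                 = ∈-++⁺ˡ x∈P
      ...   | inj₂ (here refl)         = ∈-++⁺ʳ P (here refl)
      ...   | inj₂ (there (here x≡q))  = ⊥-elim (x≢q x≡q)
      ...   | inj₂ (there (there x∈Q)) = ∈-++⁺ʳ P (there x∈Q)

      within/ : EdgesWithin vs/ es/
      within/ e∈ with ∈-map⁻ (replace² q p) e∈
      ... | (w , v) , wv∈ , refl = replace-∈ (proj₁ (within wv∈)) , replace-∈ (proj₂ (within wv∈))

      within⁺ : EdgesWithin vs es⁺
      within⁺ = EdgesWithin-∷ within (∈-++⁺ʳ P (here refl)) (∈-++⁺ʳ P (there (here refl)))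

      module C⁺ = Connected within⁺
      module C/ = Connected within/

      φ-p : φ p ≡ p
      φ-p = replace-miss p≢q

      connected⁺-φ : ∀ x → connected vs es⁺ (φ x) x ≡ true
      connected⁺-φ x with x ≟ q
      ... | yes refl = C⁺.adj⇒connected (Joins⇒adj es⁺ (here refl) (inj₁ (refl , refl)))
      ... | no _     = C⁺.connected-refl x

      connected⁺⇒connected/ : ∀ {w v} → connected vs es⁺ w v ≡ true → connected vs/ es/ (φ w) (φ v) ≡ true
      connected⁺⇒connected/ = C⁺.connected-ind (λ w v → connected vs/ es/ (φ w) (φ v) ≡ true)
                                                (λ u → C/.connected-refl (φ u)) step
        where
        step : ∀ {u w v} → connected vs/ es/ (φ u) (φ w) ≡ true → w ∈ vs → adj es⁺ w v ≡ true →
               connected vs/ es/ (φ u) (φ v) ≡ true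
        step {u} {w} {v} uw _ a with adj⇒Joins es⁺ w v a
        ... | _ , here refl , inj₁ (refl , refl) =
          subst (λ z → connected vs/ es/ (φ u) z ≡ true) (trans φ-p (sym (replace-hit q p))) uw
        ... | _ , here refl , inj₂ (refl , refl) =
          subst (λ z → connected vs/ es/ (φ u) z ≡ true) (trans (replace-hit q p) (sym φ-p)) uw
        ... | e , there e∈es , j = C/.connected-trans uw (C/.adj⇒connected (Joins⇒adj es/ (∈-map⁺ (replace² q p) e∈es) (replace-Joins j)))
          where
          replace-Joins : Joins e w v → Joins (replace² q p e) (φ w) (φ v)
          replace-Joins (inj₁ (refl , refl)) = inj₁ (refl , refl)
          replace-Joins (inj₂ (refl , refl)) = inj₂ (refl , refl)

      connected/⇒connected⁺ : ∀ {a b} → connected vs/ es/ a b ≡ true → connected vs es⁺ a b ≡ true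
      connected/⇒connected⁺ = C/.connected-ind (λ a b → connected vs es⁺ a b ≡ true) C⁺.connected-refl step
        where
        step : ∀ {u c d} → connected vs es⁺ u c ≡ true → c ∈ vs/ → adj es/ c d ≡ true → connected vs es⁺ u d ≡ true
        step {u} {c} {d} uc _ a with adj⇒Joins es/ c d a
        ... | _ , e∈ , j with ∈-map⁻ (replace² q p) e∈
        ... | (x , y) , xy∈es , refl = C⁺.connected-trans uc (image j)
          where
          xy : connected vs es⁺ x y ≡ true
          xy = C⁺.adj⇒connected (Joins⇒adj es⁺ (there xy∈es) (inj₁ (refl , refl)))
          image : Joins (φ x , φ y) c d → connected vs es⁺ c d ≡ true
          image (inj₁ (refl , refl)) =
            C⁺.connected-trans (connected⁺-φ x) (C⁺.connected-trans xy (C⁺.connected-sym (connected⁺-φ y)))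
          image (inj₂ (refl , refl)) =
            C⁺.connected-trans (connected⁺-φ y) (C⁺.connected-trans (C⁺.connected-sym xy) (C⁺.connected-sym (connected⁺-φ x)))

      φ-id : ∀ (l : List V) → q ∉ l → map φ l ≡ l
      φ-id []      _   = refl
      φ-id (x ∷ l) q∉l = cong₂ _∷_ (replace-miss (λ x≡q → q∉l (here (sym x≡q)))) (φ-id l (λ q∈l → q∉l (there q∈l)))

      map-φ-vs : map φ vs ≡ P ++ p ∷ p ∷ Q
      map-φ-vs rewrite map-++ φ P (p ∷ q ∷ Q) | φ-id P q∉P | φ-id Q q∉Q | φ-p | replace-hit q p = refl

    β₀-identify : β₀ vs/ es/ ≡ β₀ vs es⁺
    β₀-identify = sym (begin
      β₀ vs es⁺                                                   ≡⟨ β₀≡newClasses vs es⁺ ⟩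
      newClasses (connected vs es⁺) [] vs                         ≡⟨ newClasses-cong _ _ [] [] vs (λ _ _ → refl)
                                                                       (λ _ _ _ _ → true-ext connected⁺⇒connected/ connected/-φ⇒connected⁺) ⟩
      newClasses (λ a b → connected vs/ es/ (φ a) (φ b)) [] vs    ≡⟨ newClasses-map φ _ [] vs ⟩
      newClasses (connected vs/ es/) [] (map φ vs)                ≡⟨ cong (newClasses _ []) map-φ-vs ⟩
      newClasses (connected vs/ es/) [] (P ++ p ∷ p ∷ Q)          ≡⟨ newClasses-dup _ p (C/.connected-refl p) P Q [] ⟩
      newClasses (connected vs/ es/) [] vs/                       ≡⟨ sym (β₀≡newClasses vs/ es/) ⟩
      β₀ vs/ es/                                                  ∎)
      where
      open ≡-Reasoning
      connected/-φ⇒connected⁺ : ∀ {w v} → connected vs/ es/ (φ w) (φ v) ≡ true → connected vs es⁺ w v ≡ true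
      connected/-φ⇒connected⁺ {w} {v} h =
        C⁺.connected-trans (C⁺.connected-sym (connected⁺-φ w)) (C⁺.connected-trans (connected/⇒connected⁺ h) (connected⁺-φ v))

    private
      p∈vs : p ∈ vs
      p∈vs = ∈-++⁺ʳ P (here refl)

      q∈vs : q ∈ vs
      q∈vs = ∈-++⁺ʳ P (there (here refl))

      length-vs : length vs ≡ suc (length vs/)
      length-vs = trans (length-++ P) (trans (ℕP.+-suc (length P) _) (cong suc (sym (length-++ P))))

      β₁/ : β₁ vs/ es/ ≡ (length es + β₀ vs es⁺) ∸ length vs/
      β₁/ = cong₂ (λ m b → (m + b) ∸ length vs/) (length-map (replace² q p) es) β₀-identify

    β₁-identify-related : connected vs es p q ≡ true → β₁ vs es ≡ β₁ vs/ es/ ∸ 1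
    β₁-identify-related pq = begin
      (length es + β₀ vs es) ∸ length vs           ≡⟨ cong₂ (λ b n → (length es + b) ∸ n)
                                                         (AddEdge.β₀-add-related within p∈vs q∈vs pq) length-vs ⟩
      (length es + β₀ vs es⁺) ∸ (1 + length vs/)   ≡⟨ cong ((length es + β₀ vs es⁺) ∸_) (ℕP.+-comm 1 (length vs/)) ⟩
      (length es + β₀ vs es⁺) ∸ (length vs/ + 1)   ≡⟨ sym (ℕP.∸-+-assoc _ (length vs/) 1) ⟩
      (length es + β₀ vs es⁺) ∸ length vs/ ∸ 1     ≡⟨ cong (_∸ 1) (sym β₁/) ⟩
      β₁ vs/ es/ ∸ 1                               ∎
      where open ≡-Reasoning

    β₁-identify-separated : connected vs es p q ≡ false → β₁ vs es ≡ β₁ vs/ es/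
    β₁-identify-separated ¬pq = begin
      (length es + β₀ vs es) ∸ length vs             ≡⟨ cong₂ (λ b n → (length es + b) ∸ n)
                                                           (AddEdge.β₀-add-separated within p∈vs q∈vs ¬pq) length-vs ⟩
      (length es + suc (β₀ vs es⁺)) ∸ suc (length vs/) ≡⟨ cong (_∸ suc (length vs/)) (ℕP.+-suc (length es) _) ⟩
      (length es + β₀ vs es⁺) ∸ length vs/           ≡⟨ sym β₁/ ⟩
      β₁ vs/ es/                                     ∎
      where open ≡-Reasoning

    β₁≤β₁-identify : β₁ vs es ≤ β₁ vs/ es/
    β₁≤β₁-identify with connected vs es p q in pq
    ... | true  = ℕP.≤-trans (ℕP.≤-reflexive (β₁-identify-related pq)) (ℕP.m∸n≤m _ 1)
    ... | false = ℕP.≤-reflexive (β₁-identify-separated pq)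

    β₁-identify≤suc-β₁ : β₁ vs/ es/ ≤ suc (β₁ vs es)
    β₁-identify≤suc-β₁ with connected vs es p q in pq
    ... | true  = ℕP.≤-trans (ℕP.m≤n+m∸n _ 1) (ℕP.≤-reflexive (cong suc (sym (β₁-identify-related pq))))
    ... | false = ℕP.≤-trans (ℕP.≤-reflexive (sym (β₁-identify-separated pq))) (ℕP.n≤1+n _)

module Exponents where

  open import Data.Integer as ℤ using (ℤ; +_; 0ℤ; 1ℤ; -1ℤ; _+_; _-_; -_; _*_; _≤_; ∣_∣; _⊓_; +≤+; -≤+)
  import Data.Integer.Properties as ℤP
  open import Data.Integer.Tactic.RingSolver using (solve-∀)
  open import Data.List using (replicate; reverse; take; drop)
  open import Data.List.Properties using (length-reverse; reverse-++; take++drop≡id; length-take)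
  import Data.List.Relation.Unary.Any.Properties as AnyP
  open import Algebra.Properties.CommutativeSemigroup ℤP.+-commutativeSemigroup using (interchange)

  coeff : Poly → ℕ → ℤ
  coeff []      i       = 0ℤ
  coeff (a ∷ p) zero    = a
  coeff (a ∷ p) (suc i) = coeff p i

  coeff-addP : ∀ p q i → coeff (addP p q) i ≡ coeff p i + coeff q i
  coeff-addP []      q       i       = sym (ℤP.+-identityˡ (coeff q i))
  coeff-addP (a ∷ p) []      i       = sym (ℤP.+-identityʳ (coeff (a ∷ p) i))
  coeff-addP (a ∷ p) (b ∷ q) zero    = refl
  coeff-addP (a ∷ p) (b ∷ q) (suc i) = coeff-addP p q i

  coeff-scale : ∀ a q i → coeff (map (a *_) q) i ≡ a * coeff q i
  coeff-scale a []      i       = sym (ℤP.*-zeroʳ a)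
  coeff-scale a (x ∷ q) zero    = refl
  coeff-scale a (x ∷ q) (suc i) = coeff-scale a q i

  coeff-padded : ∀ n p i → coeff (replicate n 0ℤ ++ p) i ≢ 0ℤ → ∃[ j ] (i ≡ n ℕ.+ j × coeff p j ≢ 0ℤ)
  coeff-padded zero    p i       ≢0 = i , refl , ≢0
  coeff-padded (suc n) p zero    ≢0 = ⊥-elim (≢0 refl)
  coeff-padded (suc n) p (suc i) ≢0 with coeff-padded n p i ≢0
  ... | j , refl , ≢0′ = j , refl , ≢0′

  +-≢0 : ∀ x y → x + y ≢ 0ℤ → x ≢ 0ℤ ⊎ y ≢ 0ℤ
  +-≢0 x y ≢0 with x ℤ.≟ 0ℤ
  ... | no x≢0    = inj₁ x≢0
  ... | yes refl = inj₂ (λ y≡0 → ≢0 (trans (ℤP.+-identityˡ y) y≡0))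

  *-≢0 : ∀ a b → a * b ≢ 0ℤ → a ≢ 0ℤ × b ≢ 0ℤ
  *-≢0 a b ≢0 = (λ { refl → ≢0 refl }) , (λ { refl → ≢0 (ℤP.*-zeroʳ a) })

  coeff-mulP : ∀ p q i → coeff (mulP p q) i ≢ 0ℤ →
               ∃[ i₁ ] ∃[ i₂ ] (i₁ ℕ.+ i₂ ≡ i × coeff p i₁ ≢ 0ℤ × coeff q i₂ ≢ 0ℤ)
  coeff-mulP []      q i ≢0 = ⊥-elim (≢0 refl)
  coeff-mulP (a ∷ p) q i ≢0
    with +-≢0 (coeff (map (a *_) q) i) (coeff (0ℤ ∷ mulP p q) i)
              (λ ≡0 → ≢0 (trans (coeff-addP (map (a *_) q) (0ℤ ∷ mulP p q) i) ≡0))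
  ... | inj₁ ≢0ˡ = 0 , i , refl , *-≢0 a (coeff q i) (λ ≡0 → ≢0ˡ (trans (coeff-scale a q i) ≡0))
  coeff-mulP (a ∷ p) q zero    ≢0 | inj₂ ≢0ʳ = ⊥-elim (≢0ʳ refl)
  coeff-mulP (a ∷ p) q (suc i) ≢0 | inj₂ ≢0ʳ with coeff-mulP p q i ≢0ʳ
  ... | i₁ , i₂ , refl , ≢0₁ , ≢0₂ = suc i₁ , i₂ , refl , ≢0₁ , ≢0₂

  ExponentsIn : Laurent → ℤ → ℤ → Set
  ExponentsIn (lp k p) lo hi = ∀ i → coeff p i ≢ 0ℤ → lo ≤ k + + i × k + + i ≤ hi

  ExponentsIn-weaken : ∀ L {lo hi lo′ hi′} → lo′ ≤ lo → hi ≤ hi′ → ExponentsIn L lo hi → ExponentsIn L lo′ hi′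
  ExponentsIn-weaken (lp k p) lo′≤lo hi≤hi′ inL i ≢0 =
    ℤP.≤-trans lo′≤lo (proj₁ (inL i ≢0)) , ℤP.≤-trans (proj₂ (inL i ≢0)) hi≤hi′

  padded-exponent : ∀ {m k} → m ≤ k → ∀ j → m + + (∣ k - m ∣ ℕ.+ j) ≡ k + + j
  padded-exponent {m} {k} m≤k j = begin
    m + + (∣ k - m ∣ ℕ.+ j)    ≡⟨ cong (λ x → m + x) (ℤP.pos-+ ∣ k - m ∣ j) ⟩
    m + (+ ∣ k - m ∣ + + j)    ≡⟨ cong (λ d → m + (d + + j)) (ℤP.0≤i⇒+∣i∣≡i (ℤP.i≤j⇒0≤j-i m≤k)) ⟩
    m + ((k - m) + + j)        ≡⟨ solve-∀′ m k (+ j) ⟩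
    k + + j                    ∎
    where
    open ≡-Reasoning
    solve-∀′ : ∀ m k x → m + ((k - m) + x) ≡ k + x
    solve-∀′ = solve-∀

  ExponentsIn-padded : ∀ {m k p lo hi} → m ≤ k → ExponentsIn (lp k p) lo hi →
                       ∀ i → coeff (replicate ∣ k - m ∣ 0ℤ ++ p) i ≢ 0ℤ → lo ≤ m + + i × m + + i ≤ hi
  ExponentsIn-padded {m} {k} {p} {lo} {hi} m≤k inL i ≢0 with coeff-padded ∣ k - m ∣ p i ≢0
  ... | j , refl , ≢0′ = subst (λ e → lo ≤ e × e ≤ hi) (sym (padded-exponent m≤k j)) (inL j ≢0′)

  ExponentsIn-addL : ∀ L M {lo hi} → ExponentsIn L lo hi → ExponentsIn M lo hi → ExponentsIn (addL L M) lo hi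
  ExponentsIn-addL (lp k p) (lp l q) inL inM i ≢0
    with +-≢0 (coeff (replicate ∣ k - (k ⊓ l) ∣ 0ℤ ++ p) i) (coeff (replicate ∣ l - (k ⊓ l) ∣ 0ℤ ++ q) i)
              (λ ≡0 → ≢0 (trans (coeff-addP (replicate ∣ k - (k ⊓ l) ∣ 0ℤ ++ p) _ i) ≡0))
  ... | inj₁ ≢0ˡ = ExponentsIn-padded (ℤP.i⊓j≤i k l) inL i ≢0ˡ
  ... | inj₂ ≢0ʳ = ExponentsIn-padded (ℤP.i⊓j≤j k l) inM i ≢0ʳ

  ExponentsIn-mulL : ∀ L M {lo₁ hi₁ lo₂ hi₂} → ExponentsIn L lo₁ hi₁ → ExponentsIn M lo₂ hi₂ →
                     ExponentsIn (mulL L M) (lo₁ + lo₂) (hi₁ + hi₂)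
  ExponentsIn-mulL (lp k p) (lp l q) inL inM i ≢0 with coeff-mulP p q i ≢0
  ... | i₁ , i₂ , refl , ≢0₁ , ≢0₂ =
    subst (_ ≤_) (sym exponent) (ℤP.+-mono-≤ (proj₁ (inL i₁ ≢0₁)) (proj₁ (inM i₂ ≢0₂))) ,
    subst (_≤ _) (sym exponent) (ℤP.+-mono-≤ (proj₂ (inL i₁ ≢0₁)) (proj₂ (inM i₂ ≢0₂)))
    where
    exponent : (k + l) + + (i₁ ℕ.+ i₂) ≡ (k + + i₁) + (l + + i₂)
    exponent = trans (cong (λ x → (k + l) + x) (ℤP.pos-+ i₁ i₂)) (interchange k l (+ i₁) (+ i₂))

  ExponentsIn-sumL : ∀ Ls {lo hi} → (∀ L → L ∈ Ls → ExponentsIn L lo hi) → ExponentsIn (sumL Ls) lo hi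
  ExponentsIn-sumL []       all i ≢0 = ⊥-elim (≢0 refl)
  ExponentsIn-sumL (L ∷ Ls) all =
    ExponentsIn-addL L (sumL Ls) (all L (here refl)) (ExponentsIn-sumL Ls (λ L′ L′∈ → all L′ (there L′∈)))

  ExponentsIn-constant : ∀ k c → ExponentsIn (lp k (c ∷ [])) k k
  ExponentsIn-constant k c zero    ≢0 = ℤP.≤-reflexive (sym (ℤP.+-identityʳ k)) , ℤP.≤-reflexive (ℤP.+-identityʳ k)
  ExponentsIn-constant k c (suc i) ≢0 = ⊥-elim (≢0 refl)

  ExponentsIn-signL : ∀ n → ExponentsIn (signL n) 0ℤ 0ℤ
  ExponentsIn-signL zero    = ExponentsIn-constant 0ℤ 1ℤ
  ExponentsIn-signL (suc n) =
    ExponentsIn-mulL (lp 0ℤ (-1ℤ ∷ [])) (signL n) (ExponentsIn-constant 0ℤ -1ℤ) (ExponentsIn-signL n)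

  ExponentsIn-xL : ExponentsIn xL -1ℤ 1ℤ
  ExponentsIn-xL zero                ≢0 = ℤP.≤-refl , -≤+
  ExponentsIn-xL (suc zero)          ≢0 = -≤+ , +≤+ ℕ.z≤n
  ExponentsIn-xL (suc (suc zero))    ≢0 = -≤+ , ℤP.≤-refl
  ExponentsIn-xL (suc (suc (suc i))) ≢0 = ⊥-elim (≢0 refl)

  ExponentsIn-powL-xL : ∀ n → ExponentsIn (powL xL n) (- + n) (+ n)
  ExponentsIn-powL-xL zero    = ExponentsIn-constant 0ℤ 1ℤ
  ExponentsIn-powL-xL (suc n) =
    ExponentsIn-weaken (powL xL (suc n)) (ℤP.≤-reflexive (sym (-1-neg n))) ℤP.≤-refl
      (ExponentsIn-mulL xL (powL xL n) ExponentsIn-xL (ExponentsIn-powL-xL n))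
    where
    -1-neg : ∀ n → -1ℤ + - + n ≡ - + suc n
    -1-neg zero    = refl
    -1-neg (suc n) = refl

  dropZeros-view : ∀ p → dropZeros p ≡ [] ⊎
    ∃[ z ] ∃[ x ] ∃[ q ] (p ≡ z ++ x ∷ q × dropZeros p ≡ x ∷ q × x ≢ 0ℤ)
  dropZeros-view []      = inj₁ refl
  dropZeros-view (a ∷ p) with a ℤ.≟ 0ℤ
  ... | no a≢0    = inj₂ ([] , a , p , refl , refl , a≢0)
  ... | yes refl with dropZeros-view p
  ...   | inj₁ empty = inj₁ empty
  ...   | inj₂ (z , x , q , refl , leading , x≢0) = inj₂ (0ℤ ∷ z , x , q , refl , leading , x≢0)

  dropZeros-zeros : ∀ zs r → (∀ {x} → x ∈ zs → x ≡ 0ℤ) → dropZeros (zs ++ r) ≡ dropZeros r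
  dropZeros-zeros []       r zeros = refl
  dropZeros-zeros (z ∷ zs) r zeros with zeros (here refl)
  ... | refl = dropZeros-zeros zs r (λ x∈ → zeros (there x∈))

  length-dropZeros : ∀ r → length (dropZeros r) ℕ.≤ length r
  length-dropZeros []      = ℕ.z≤n
  length-dropZeros (a ∷ r) with isZero a
  ... | true  = ℕP.m≤n⇒m≤1+n (length-dropZeros r)
  ... | false = ℕP.≤-refl

  coeff-++ : ∀ z r i → coeff (z ++ r) (length z ℕ.+ i) ≡ coeff r i
  coeff-++ []      r i = refl
  coeff-++ (x ∷ z) r i = coeff-++ z r i

  coeff-drop : ∀ d q t → coeff (drop d q) t ≡ coeff q (d ℕ.+ t)
  coeff-drop zero    q       t = refl
  coeff-drop (suc d) []      t = refl
  coeff-drop (suc d) (x ∷ q) t = coeff-drop d q t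

  coeffs-zero : ∀ q → (∀ t → coeff q t ≡ 0ℤ) → ∀ {x} → x ∈ q → x ≡ 0ℤ
  coeffs-zero (y ∷ q) zeros (here refl) = zeros 0
  coeffs-zero (y ∷ q) zeros (there x∈q) = coeffs-zero q (λ t → zeros (suc t)) x∈q

  length-trailing : ∀ q d → (∀ t → coeff q (d ℕ.+ t) ≡ 0ℤ) → length (dropZeros (reverse q)) ℕ.≤ d
  length-trailing q d zero-tail = begin
    length (dropZeros (reverse q))                                  ≡⟨ cong (λ r → length (dropZeros (reverse r))) (sym (take++drop≡id d q)) ⟩
    length (dropZeros (reverse (take d q ++ drop d q)))             ≡⟨ cong (λ r → length (dropZeros r)) (reverse-++ (take d q) (drop d q)) ⟩
    length (dropZeros (reverse (drop d q) ++ reverse (take d q)))   ≡⟨ cong length (dropZeros-zeros (reverse (drop d q)) _ zero-dropped) ⟩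
    length (dropZeros (reverse (take d q)))                         ≤⟨ length-dropZeros (reverse (take d q)) ⟩
    length (reverse (take d q))                                     ≡⟨ length-reverse (take d q) ⟩
    length (take d q)                                               ≡⟨ length-take d q ⟩
    d ℕ.⊓ length q                                                  ≤⟨ ℕP.m⊓n≤m d (length q) ⟩
    d                                                               ∎
    where
    open ℕP.≤-Reasoning
    zero-dropped : ∀ {x} → x ∈ reverse (drop d q) → x ≡ 0ℤ
    zero-dropped x∈ = coeffs-zero (drop d q) (λ t → trans (coeff-drop d q t) (zero-tail t)) (AnyP.reverse⁻ x∈)

  span-lp≤ : ∀ k p d → (∀ i j → coeff p i ≢ 0ℤ → coeff p j ≢ 0ℤ → j ℕ.≤ i ℕ.+ d) → span (lp k p) ℕ.≤ d
  span-lp≤ k p d spread with dropZeros-view p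
  ... | inj₁ empty rewrite empty = ℕ.z≤n
  ... | inj₂ (z , x , q , refl , leading , x≢0) rewrite leading =
    ℕP.∸-monoˡ-≤ 1 (ℕP.≤-trans (ℕP.≤-reflexive (length-reverse (dropZeros (reverse (x ∷ q)))))
                               (length-trailing (x ∷ q) (suc d) beyond))
    where
    beyond : ∀ t → coeff (x ∷ q) (suc d ℕ.+ t) ≡ 0ℤ
    beyond t with coeff (x ∷ q) (suc d ℕ.+ t) ℤ.≟ 0ℤ
    ... | yes ≡0 = ≡0
    ... | no ≢0 = ⊥-elim (ℕP.1+n≰n (ℕP.≤-trans too-far (ℕP.m≤m+n d t)))
      where
      far-index : length z ℕ.+ (suc d ℕ.+ t) ℕ.≤ (length z ℕ.+ 0) ℕ.+ d
      far-index = spread (length z ℕ.+ 0) (length z ℕ.+ (suc d ℕ.+ t))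
                    (λ ≡0 → x≢0 (trans (sym (coeff-++ z (x ∷ q) 0)) ≡0))
                    (λ ≡0 → ≢0 (trans (sym (coeff-++ z (x ∷ q) (suc d ℕ.+ t))) ≡0))
      too-far : suc (d ℕ.+ t) ℕ.≤ d
      too-far = ℕP.+-cancelˡ-≤ (length z) _ _
                  (subst (length z ℕ.+ (suc d ℕ.+ t) ℕ.≤_) (cong (ℕ._+ d) (ℕP.+-identityʳ (length z))) far-index)

  span≤ : ∀ L {lo hi} → ExponentsIn L lo hi → lo ≤ hi → + span L ≤ hi - lo
  span≤ (lp k p) {lo} {hi} inL lo≤hi =
    subst (λ w → + span (lp k p) ≤ w) width (+≤+ (span-lp≤ k p ∣ hi - lo ∣ spread))
    where
    width : + ∣ hi - lo ∣ ≡ hi - lo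
    width = ℤP.0≤i⇒+∣i∣≡i (ℤP.i≤j⇒0≤j-i lo≤hi)
    spread : ∀ i j → coeff p i ≢ 0ℤ → coeff p j ≢ 0ℤ → j ℕ.≤ i ℕ.+ ∣ hi - lo ∣
    spread i j ≢0ᵢ ≢0ⱼ = ℤP.drop‿+≤+ (begin
      + j                                  ≡⟨ cancel k (+ j) ⟩
      - k + (k + + j)                      ≤⟨ ℤP.+-monoʳ-≤ (- k) (proj₂ (inL j ≢0ⱼ)) ⟩
      - k + hi                             ≡⟨ cong (λ h → - k + h) (shift lo hi) ⟩
      - k + (lo + (hi - lo))               ≤⟨ ℤP.+-monoʳ-≤ (- k) (ℤP.+-monoˡ-≤ (hi - lo) (proj₁ (inL i ≢0ᵢ))) ⟩
      - k + ((k + + i) + (hi - lo))        ≡⟨ cong (λ w → - k + ((k + + i) + w)) (sym width) ⟩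
      - k + ((k + + i) + + ∣ hi - lo ∣)    ≡⟨ cancel′ k (+ i) (+ ∣ hi - lo ∣) ⟩
      + i + + ∣ hi - lo ∣                  ≡⟨ sym (ℤP.pos-+ i ∣ hi - lo ∣) ⟩
      + (i ℕ.+ ∣ hi - lo ∣)                ∎)
      where
      open ℤP.≤-Reasoning
      cancel : ∀ a b → b ≡ - a + (a + b)
      cancel = solve-∀
      shift : ∀ a b → b ≡ a + (b - a)
      shift = solve-∀
      cancel′ : ∀ a b c → - a + ((a + b) + c) ≡ b + c
      cancel′ = solve-∀

allFin-split : ∀ {n} (i : Fin n) →
  ∃[ before ] ∃[ after ] (allFin n ≡ before ++ i ∷ after × i ∉ before × i ∉ after)
allFin-split {suc n} zero = [] , tabulate suc , refl , (λ ()) , zero∉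
  where
  zero∉ : zero ∉ tabulate suc
  zero∉ z∈ with ∈-tabulate⁻ z∈
  ... | _ , ()
allFin-split {suc n} (suc i) with allFin-split i
... | before , after , split , i∉before , i∉after =
  zero ∷ map suc before , map suc after , split′ ,
  (λ { (there si∈) → suc∉map i∉before si∈ }) , suc∉map i∉after
  where
  split′ : allFin (suc n) ≡ (zero ∷ map suc before) ++ suc i ∷ map suc after
  split′ = cong (zero ∷_) (begin
    tabulate suc                           ≡⟨ sym (map-tabulate (λ j → j) suc) ⟩
    map suc (allFin n)                     ≡⟨ cong (map suc) split ⟩
    map suc (before ++ i ∷ after)          ≡⟨ map-++ suc before (i ∷ after) ⟩
    map suc before ++ suc i ∷ map suc after ∎)
    where open ≡-Reasoning
  suc∉map : ∀ {js} → i ∉ js → suc i ∉ map suc js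
  suc∉map i∉js si∈ with ∈-map⁻ suc si∈
  ... | j , j∈js , refl = i∉js j∈js

∉-∷ : ∀ {n} {i j : Fin n} {js} → j ≢ i → j ∉ js → j ∉ i ∷ js
∉-∷ j≢i j∉js (here j≡i)  = j≢i j≡i
∉-∷ j≢i j∉js (there j∈js) = j∉js j∈js

module _ {A : Set} {n : ℕ} where

  lookup-set : ∀ (xs : Vec A n) i y j →
    (j ≡ i × lookup (xs [ i ]≔ y) j ≡ y) ⊎ (j ≢ i × lookup (xs [ i ]≔ y) j ≡ lookup xs j)
  lookup-set xs i y j with j ≟ᶠ i
  ... | yes refl = inj₁ (refl , lookup∘update i xs y)
  ... | no j≢i   = inj₂ (j≢i , lookup∘update′ j≢i xs y)

  vec-ext : ∀ {xs ys : Vec A n} → (∀ j → lookup xs j ≡ lookup ys j) → xs ≡ ys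
  vec-ext {xs} {ys} xs≗ys = trans (sym (tabulate∘lookup xs)) (trans (tabulate-cong xs≗ys) (tabulate∘lookup ys))

  set-lookup : ∀ (xs : Vec A n) i {y} → lookup xs i ≡ y → xs [ i ]≔ y ≡ xs
  set-lookup xs i refl = []≔-lookup xs i

module Resolution (D : Diagram) where

  open import Data.Nat using (_∸_; _≤_)
  open import Data.Vec using (replicate)
  open import Data.List using (concat)
  open import Data.List.Properties using (concatMap-cong; concatMap-++; map-cong; map-cong-local; map-∘)
  import Data.List.Relation.Unary.All as All
  open import Data.List.Membership.Propositional.Properties using (∈-allFin; ∈-concat⁺′; ∈-concat⁻′)

  Vertex : Set
  Vertex = SV (nv D) (nc D)

  State : Set
  State = Vec Res (nc D)

  open Connectivity (_≟SV_ {nv D} {nc D}) public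

  crossingVertices : Fin (nc D) → Res → List Vertex
  crossingVertices i rX = inj₂ (i , zero) ∷ []
  crossingVertices i _  = inj₂ (i , zero) ∷ inj₂ (i , suc zero) ∷ []

  crossingVertices-∈ : ∀ {j r x} → x ∈ crossingVertices j r → ∃[ t ] (x ≡ inj₂ (j , t))
  crossingVertices-∈ {r = rA} (here refl)         = zero , refl
  crossingVertices-∈ {r = rA} (there (here refl)) = suc zero , refl
  crossingVertices-∈ {r = rB} (here refl)         = zero , refl
  crossingVertices-∈ {r = rB} (there (here refl)) = suc zero , refl
  crossingVertices-∈ {r = rX} (here refl)         = zero , refl
  crossingVertices-∈ {r = rP} (here refl)         = zero , refl
  crossingVertices-∈ {r = rP} (there (here refl)) = suc zero , refl

  -- crossingVertices j Y is the same list for Y = rA, rB and rP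
  two-arcs : ∀ j t → inj₂ (j , t) ∈ crossingVertices j rP
  two-arcs j zero       = here refl
  two-arcs j (suc zero) = there (here refl)

  arc-∈ : ∀ j r k → inj₂ (j , arcOf r k) ∈ crossingVertices j r
  arc-∈ j rA k = two-arcs j (arcOf rA k)
  arc-∈ j rB k = two-arcs j (arcOf rB k)
  arc-∈ j rX k = here refl
  arc-∈ j rP k = two-arcs j (arcOf rP k)

  -- exposes the local helper of resVerts, which cannot be referred to by name
  private
    resVerts-view : ∀ σ → Σ (Fin (nc D) → List Vertex) λ f →
                    resVerts D σ ≡ map inj₁ (allFin (nv D)) ++ concatMap f (allFin (nc D))
    resVerts-view σ = _ , refl

    crossVerts≗ : ∀ σ i → proj₁ (resVerts-view σ) i ≡ crossingVertices i (lookup σ i)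
    crossVerts≗ σ i with lookup σ i
    ... | rA = refl
    ... | rB = refl
    ... | rX = refl
    ... | rP = refl

  resVerts-crossings : ∀ σ → resVerts D σ ≡
    map inj₁ (allFin (nv D)) ++ concatMap (λ i → crossingVertices i (lookup σ i)) (allFin (nc D))
  resVerts-crossings σ =
    trans (proj₂ (resVerts-view σ)) (cong (map inj₁ (allFin (nv D)) ++_) (concatMap-cong (crossVerts≗ σ) (allFin (nc D))))

  resEnd-∈ : ∀ σ x → resEnd D σ x ∈ resVerts D σ
  resEnd-∈ σ x rewrite resVerts-crossings σ with x
  ... | vert v   = ∈-++⁺ˡ (∈-map⁺ inj₁ (∈-allFin v))
  ... | slot i k = ∈-++⁺ʳ (map inj₁ (allFin (nv D)))
                     (∈-concat⁺′ (arc-∈ i (lookup σ i) k) (∈-map⁺ (λ i → crossingVertices i (lookup σ i)) (∈-allFin i)))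

  resEdge : State → Fin (ne D) → Edge
  resEdge σ e = resEnd D σ (end D e zero) , resEnd D σ (end D e (suc zero))

  resEdges-within : ∀ σ → EdgesWithin (resVerts D σ) (resEdges D σ)
  resEdges-within σ e∈ with ∈-map⁻ (resEdge σ) e∈
  ... | e , _ , refl = resEnd-∈ σ (end D e zero) , resEnd-∈ σ (end D e (suc zero))

  b₁ : State → ℕ
  b₁ σ = β₁ (resVerts D σ) (resEdges D σ)

  allP : State
  allP = replicate (nc D) rP

  Linked : State → Vertex → Vertex → Bool
  Linked σ = connected (resVerts D σ) (resEdges D σ)

  module AtCrossing (σ : State) (i : Fin (nc D)) where

    set : Res → State
    set Y = σ [ i ]≔ Y

    u₀ u₁ : Vertex
    u₀ = inj₂ (i , zero)
    u₁ = inj₂ (i , suc zero)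

    u₀≢u₁ : u₀ ≢ u₁
    u₀≢u₁ ()

    private
      vertsAt : State → Fin (nc D) → List Vertex
      vertsAt τ j = crossingVertices j (lookup τ j)

      before after : List (Fin (nc D))
      before = proj₁ (allFin-split i)
      after  = proj₁ (proj₂ (allFin-split i))

      split : allFin (nc D) ≡ before ++ i ∷ after
      split = proj₁ (proj₂ (proj₂ (allFin-split i)))

      i∉before : i ∉ before
      i∉before = proj₁ (proj₂ (proj₂ (proj₂ (allFin-split i))))

      i∉after : i ∉ after
      i∉after = proj₂ (proj₂ (proj₂ (proj₂ (allFin-split i))))

      lookup-set-other : ∀ Y {j} → j ≢ i → lookup (set Y) j ≡ lookup σ j
      lookup-set-other Y j≢i = lookup∘update′ j≢i σ Y

      unchanged : ∀ Y js → i ∉ js → concatMap (vertsAt (set Y)) js ≡ concatMap (vertsAt σ) js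
      unchanged Y js i∉js = cong concat (map-cong-local {f = vertsAt (set Y)} {g = vertsAt σ} (All.tabulate λ {j} j∈js →
        cong (crossingVertices j) (lookup-set-other Y (λ { refl → i∉js j∈js }))))

    P Q : List Vertex
    P = map inj₁ (allFin (nv D)) ++ concatMap (vertsAt σ) before
    Q = concatMap (vertsAt σ) after

    resVerts-set : ∀ Y → resVerts D (set Y) ≡ P ++ crossingVertices i Y ++ Q
    resVerts-set Y = begin
      resVerts D (set Y)
        ≡⟨ resVerts-crossings (set Y) ⟩
      vs₀ ++ concatMap (vertsAt (set Y)) (allFin (nc D))
        ≡⟨ cong (λ js → vs₀ ++ concatMap (vertsAt (set Y)) js) split ⟩
      vs₀ ++ concatMap (vertsAt (set Y)) (before ++ i ∷ after)
        ≡⟨ cong (vs₀ ++_) (concatMap-++ (vertsAt (set Y)) before (i ∷ after)) ⟩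
      vs₀ ++ (concatMap (vertsAt (set Y)) before ++ vertsAt (set Y) i ++ concatMap (vertsAt (set Y)) after)
        ≡⟨ cong₂ (λ xs ys → vs₀ ++ (xs ++ ys)) (unchanged Y before i∉before)
                 (cong₂ _++_ (cong (crossingVertices i) (lookup∘update i σ Y)) (unchanged Y after i∉after)) ⟩
      vs₀ ++ (concatMap (vertsAt σ) before ++ crossingVertices i Y ++ Q)
        ≡⟨ sym (++-assoc vs₀ _ _) ⟩
      P ++ crossingVertices i Y ++ Q
        ∎
      where
      open ≡-Reasoning
      vs₀ = map inj₁ (allFin (nv D))

    private
      u₁∉crossings : ∀ js → i ∉ js → u₁ ∉ concatMap (vertsAt σ) js
      u₁∉crossings js i∉js u₁∈ with ∈-concat⁻′ (map (vertsAt σ) js) u₁∈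
      ... | xs , u₁∈xs , xs∈ with ∈-map⁻ (vertsAt σ) xs∈
      ... | j , j∈js , refl with crossingVertices-∈ u₁∈xs
      ... | _ , refl = i∉js j∈js

    u₁∉P : u₁ ∉ P
    u₁∉P u₁∈ with ∈-++⁻ (map inj₁ (allFin (nv D))) u₁∈
    ... | inj₁ u₁∈vertices with ∈-map⁻ inj₁ u₁∈vertices
    ...   | _ , _ , ()
    u₁∉P u₁∈ | inj₂ u₁∈crossings = u₁∉crossings before i∉before u₁∈crossings

    u₁∉Q : u₁ ∉ Q
    u₁∉Q = u₁∉crossings after i∉after

    private
      crossingOf : Vertex → Fin (nc D)
      crossingOf (inj₁ _)       = i
      crossingOf (inj₂ (j , _)) = j

      replace-crossing : ∀ t → replace u₁ u₀ (inj₂ (i , t)) ≡ u₀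
      replace-crossing zero       = replace-miss {u₁} {u₀} u₀≢u₁
      replace-crossing (suc zero) = replace-hit u₁ u₀

      resEnd-X-slot : ∀ Y j k → Dec (j ≡ i) →
        inj₂ (j , arcOf (lookup (set rX) j) k) ≡ replace u₁ u₀ (inj₂ (j , arcOf (lookup (set Y) j) k))
      resEnd-X-slot Y j k (yes refl) = begin
        inj₂ (i , arcOf (lookup (set rX) i) k) ≡⟨ cong (λ r → inj₂ (i , arcOf r k)) (lookup∘update i σ rX) ⟩
        u₀                                     ≡⟨ sym (replace-crossing (arcOf (lookup (set Y) i) k)) ⟩
        replace u₁ u₀ (inj₂ (i , arcOf (lookup (set Y) i) k)) ∎
        where open ≡-Reasoning
      resEnd-X-slot Y j k (no j≢i) = begin
        inj₂ (j , arcOf (lookup (set rX) j) k) ≡⟨ cong (λ r → inj₂ (j , arcOf r k)) (lookup-set-other rX j≢i) ⟩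
        inj₂ (j , arcOf (lookup σ j) k)        ≡⟨ cong (λ r → inj₂ (j , arcOf r k)) (sym (lookup-set-other Y j≢i)) ⟩
        inj₂ (j , arcOf (lookup (set Y) j) k)  ≡⟨ sym (replace-miss {u₁} {u₀} (λ at-u₁ → j≢i (cong crossingOf at-u₁))) ⟩
        replace u₁ u₀ (inj₂ (j , arcOf (lookup (set Y) j) k)) ∎
        where open ≡-Reasoning

      resEnd-X : ∀ Y x → resEnd D (set rX) x ≡ replace u₁ u₀ (resEnd D (set Y) x)
      resEnd-X Y (vert v)   = sym (replace-miss {u₁} {u₀} (λ ()))
      resEnd-X Y (slot j k) = resEnd-X-slot Y j k (j ≟ᶠ i)

    resEdges-X : ∀ Y → resEdges D (set rX) ≡ map (replace² u₁ u₀) (resEdges D (set Y))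
    resEdges-X Y = trans (map-cong (λ e → cong₂ _,_ (resEnd-X Y (end D e zero)) (resEnd-X Y (end D e (suc zero))))
                                   (allFin (ne D)))
                         (map-∘ (allFin (ne D)))

    -- For a smoothing Y, the X-resolution at i is the Y-resolution with u₁ identified with u₀.
    module Smoothing (Y : Res) (Y≢X : Y ≢ rX) where

      private
        two-vertices : ∀ Y → Y ≢ rX → crossingVertices i Y ≡ u₀ ∷ u₁ ∷ []
        two-vertices rA _   = refl
        two-vertices rB _   = refl
        two-vertices rX X≢X = ⊥-elim (X≢X refl)
        two-vertices rP _   = refl

        shape : resVerts D (set Y) ≡ P ++ u₀ ∷ u₁ ∷ Q
        shape = trans (resVerts-set Y) (cong (λ vs → P ++ vs ++ Q) (two-vertices Y Y≢X))

        module I = Identify P Q u₀≢u₁ u₁∉P u₁∉Q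
                     (subst (λ vs → EdgesWithin vs (resEdges D (set Y))) shape (resEdges-within (set Y)))

        b₁-Y : b₁ (set Y) ≡ β₁ I.vs (resEdges D (set Y))
        b₁-Y = cong (λ vs → β₁ vs (resEdges D (set Y))) shape

        b₁-X : b₁ (set rX) ≡ β₁ I.vs/ I.es/
        b₁-X = cong₂ β₁ (resVerts-set rX) (resEdges-X Y)

        Linked-Y : Linked (set Y) u₀ u₁ ≡ connected I.vs (resEdges D (set Y)) u₀ u₁
        Linked-Y = cong (λ vs → connected vs (resEdges D (set Y)) u₀ u₁) shape

      b₁≤b₁-X : b₁ (set Y) ≤ b₁ (set rX)
      b₁≤b₁-X = subst₂ _≤_ (sym b₁-Y) (sym b₁-X) I.β₁≤β₁-identify

      b₁-X≤suc-b₁ : b₁ (set rX) ≤ suc (b₁ (set Y))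
      b₁-X≤suc-b₁ = subst₂ (λ m n → m ≤ suc n) (sym b₁-X) (sym b₁-Y) I.β₁-identify≤suc-β₁

      b₁-linked : Linked (set Y) u₀ u₁ ≡ true → b₁ (set Y) ≡ b₁ (set rX) ∸ 1
      b₁-linked linked = trans b₁-Y (trans (I.β₁-identify-related (trans (sym Linked-Y) linked)) (cong (_∸ 1) (sym b₁-X)))

      b₁-unlinked : Linked (set Y) u₀ u₁ ≡ false → b₁ (set Y) ≡ b₁ (set rX)
      b₁-unlinked unlinked = trans b₁-Y (trans (I.β₁-identify-separated (trans (sym Linked-Y) unlinked)) (sym b₁-X))

    private
      at : Fin 2 → Vertex
      at t = inj₂ (i , t)

      resEnd-slot : ∀ Y k → resEnd D (set Y) (slot i k) ≡ at (arcOf Y k)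
      resEnd-slot Y k = cong (λ r → at (arcOf r k)) (lookup∘update i σ Y)

      data EndView (x : End (nv D) (nc D)) : Set where
        at-i      : ∀ k → x ≡ slot i k → EndView x
        elsewhere : (∀ Y → resEnd D (set Y) x ≡ resEnd D σ x) → resEnd D σ x ≢ u₀ → EndView x

      endView : ∀ x → EndView x
      endView (vert v)   = elsewhere (λ _ → refl) (λ ())
      endView (slot j k) with j ≟ᶠ i
      ... | yes refl = at-i k refl
      ... | no j≢i   = elsewhere (λ Y → cong (λ r → inj₂ (j , arcOf r k)) (lookup-set-other Y j≢i))
                                 (λ at-u₀ → j≢i (cong crossingOf at-u₀))

      -- differ (arcOf rA k) (arcOf rB k) is true exactly for the slots 0 and 2 of the P-strand u₀
      differ : Fin 2 → Fin 2 → Bool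
      differ zero       zero       = false
      differ zero       (suc zero) = true
      differ (suc zero) zero       = true
      differ (suc zero) (suc zero) = false

      -- If neither resolution links u₀ and u₁, then side is constant on components of the
      -- P-resolution, but side u₀ ≢ side u₁.
      module Unlinked (¬A : Linked (set rA) u₀ u₁ ≡ false) (¬B : Linked (set rB) u₀ u₁ ≡ false) where

        module A = Connected (resEdges-within (set rA))
        module B = Connected (resEdges-within (set rB))
        module P′ = Connected (resEdges-within (set rP))

        RA RB : Vertex → Vertex → Bool
        RA = Linked (set rA)
        RB = Linked (set rB)

        _~A_ _~B_ : Vertex → Vertex → Set
        x ~A y = RA x y ≡ true
        x ~B y = RB x y ≡ true

        side : Vertex → Bool
        side x = eqb x u₀ ∨ ((RA x u₁ ∧ RB x u₀) ∨ (RA x u₀ ∧ RB x u₁))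

        ¬A′ : RA u₁ u₀ ≡ false
        ¬A′ = ¬-not (λ h → bool-absurd (A.connected-sym h) ¬A)

        ¬B′ : RB u₁ u₀ ≡ false
        ¬B′ = ¬-not (λ h → bool-absurd (B.connected-sym h) ¬B)

        side-u₀ : side u₀ ≡ true
        side-u₀ rewrite eqb-refl u₀ = refl

        side-u₁ : side u₁ ≡ false
        side-u₁ rewrite ≢⇒eqb-false {u₁} {u₀} (λ ()) | A.connected-refl u₁ | B.connected-refl u₁ | ¬A′ | ¬B′ = refl

        RA-class : ∀ {a b} → RA a b ≡ true → ∀ t → RA a t ≡ RA b t
        RA-class ab t = true-ext (A.connected-trans (A.connected-sym ab)) (A.connected-trans ab)

        RB-class : ∀ {a b} → RB a b ≡ true → ∀ t → RB a t ≡ RB b t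
        RB-class ab t = true-ext (B.connected-trans (B.connected-sym ab)) (B.connected-trans ab)

        side-away : ∀ {a b} → a ≢ u₀ → b ≢ u₀ → RA a b ≡ true → RB a b ≡ true → side a ≡ side b
        side-away a≢u₀ b≢u₀ ab ab′
          rewrite ≢⇒eqb-false a≢u₀ | ≢⇒eqb-false b≢u₀
                | RA-class ab u₁ | RA-class ab u₀ | RB-class ab′ u₁ | RB-class ab′ u₀ = refl

        side-slot : ∀ k → side (at (arcOf rP k)) ≡ differ (arcOf rA k) (arcOf rB k)
        side-slot zero                   = side-u₀
        side-slot (suc zero)             = side-u₁
        side-slot (suc (suc zero))       = side-u₀
        side-slot (suc (suc (suc zero))) = side-u₁

        side-near : ∀ s t {b} → b ≢ u₀ → RA (at s) b ≡ true → RB (at t) b ≡ true → side b ≡ differ s t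
        side-near s t b≢u₀ sb tb
          rewrite ≢⇒eqb-false b≢u₀
                | sym (RA-class sb u₁) | sym (RA-class sb u₀) | sym (RB-class tb u₁) | sym (RB-class tb u₀) = cases s t
          where
          cases : ∀ s t → (RA (at s) u₁ ∧ RB (at t) u₀) ∨ (RA (at s) u₀ ∧ RB (at t) u₁) ≡ differ s t
          cases zero       zero       rewrite ¬A | A.connected-refl u₀ | ¬B = refl
          cases zero       (suc zero) rewrite ¬A | A.connected-refl u₀ | B.connected-refl u₁ = refl
          cases (suc zero) zero       rewrite A.connected-refl u₁ | B.connected-refl u₀ = refl
          cases (suc zero) (suc zero) rewrite A.connected-refl u₁ | ¬B′ | ¬A′ = refl

        same-arcA : ∀ s t → RA (at s) (at t) ≡ true → s ≡ t
        same-arcA zero       zero       _  = refl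
        same-arcA zero       (suc zero) st = ⊥-elim (bool-absurd st ¬A)
        same-arcA (suc zero) zero       st = ⊥-elim (bool-absurd st ¬A′)
        same-arcA (suc zero) (suc zero) _  = refl

        same-arcB : ∀ s t → RB (at s) (at t) ≡ true → s ≡ t
        same-arcB zero       zero       _  = refl
        same-arcB zero       (suc zero) st = ⊥-elim (bool-absurd st ¬B)
        same-arcB (suc zero) zero       st = ⊥-elim (bool-absurd st ¬B′)
        same-arcB (suc zero) (suc zero) _  = refl

        side-slot-away : ∀ k {b} → b ≢ u₀ → RA (at (arcOf rA k)) b ≡ true → RB (at (arcOf rB k)) b ≡ true →
                         side (at (arcOf rP k)) ≡ side b
        side-slot-away k b≢u₀ kb kb′ = trans (side-slot k) (sym (side-near _ _ b≢u₀ kb kb′))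

        side-ends : ∀ a b →
          RA (resEnd D (set rA) a) (resEnd D (set rA) b) ≡ true →
          RB (resEnd D (set rB) a) (resEnd D (set rB) b) ≡ true →
          side (resEnd D (set rP) a) ≡ side (resEnd D (set rP) b)
        side-ends a b ab ab′ with endView a | endView b
        ... | elsewhere fixa a≢u₀ | elsewhere fixb b≢u₀ =
          trans (cong side (fixa rP))
            (trans (side-away a≢u₀ b≢u₀ (subst₂ _~A_ (fixa rA) (fixb rA) ab) (subst₂ _~B_ (fixa rB) (fixb rB) ab′))
                   (sym (cong side (fixb rP))))
        ... | at-i k refl | elsewhere fixb b≢u₀ =
          trans (cong side (resEnd-slot rP k))
            (trans (side-slot-away k b≢u₀ (subst₂ _~A_ (resEnd-slot rA k) (fixb rA) ab)
                                          (subst₂ _~B_ (resEnd-slot rB k) (fixb rB) ab′))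
                   (sym (cong side (fixb rP))))
        ... | elsewhere fixa a≢u₀ | at-i k refl =
          trans (cong side (fixa rP))
            (trans (sym (side-slot-away k a≢u₀ (subst₂ _~A_ (resEnd-slot rA k) (fixa rA) (A.connected-sym ab))
                                               (subst₂ _~B_ (resEnd-slot rB k) (fixa rB) (B.connected-sym ab′))))
                   (sym (cong side (resEnd-slot rP k))))
        ... | at-i k refl | at-i k′ refl =
          trans (cong side (resEnd-slot rP k))
            (trans (side-slot k)
              (trans (cong₂ differ (same-arcA _ _ (subst₂ _~A_ (resEnd-slot rA k) (resEnd-slot rA k′) ab))
                                   (same-arcB _ _ (subst₂ _~B_ (resEnd-slot rB k) (resEnd-slot rB k′) ab′)))
                (trans (sym (side-slot k′)) (sym (cong side (resEnd-slot rP k′))))))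

        side-adj : ∀ {w v} → adj (resEdges D (set rP)) w v ≡ true → side w ≡ side v
        side-adj {w} {v} a with adj⇒Joins (resEdges D (set rP)) w v a
        ... | _ , e∈ , joins with ∈-map⁻ (resEdge (set rP)) e∈
        ... | e , _ , refl = oriented joins
          where
          ends~A : resEnd D (set rA) (end D e zero) ~A resEnd D (set rA) (end D e (suc zero))
          ends~A = A.adj⇒connected (Joins⇒adj (resEdges D (set rA)) (∈-map⁺ (resEdge (set rA)) (∈-allFin e)) (inj₁ (refl , refl)))
          ends~B : resEnd D (set rB) (end D e zero) ~B resEnd D (set rB) (end D e (suc zero))
          ends~B = B.adj⇒connected (Joins⇒adj (resEdges D (set rB)) (∈-map⁺ (resEdge (set rB)) (∈-allFin e)) (inj₁ (refl , refl)))
          oriented : Joins (resEdge (set rP) e) w v → side w ≡ side v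
          oriented (inj₁ (refl , refl)) = side-ends _ _ ends~A ends~B
          oriented (inj₂ (refl , refl)) = sym (side-ends _ _ ends~A ends~B)

        unlinked-P : Linked (set rP) u₀ u₁ ≡ false
        unlinked-P = ¬-not λ linked →
          bool-absurd (trans (sym (P′.connected-ind (λ w v → side w ≡ side v) (λ _ → refl)
                                                   (λ same _ a → trans same (side-adj a)) linked))
                             side-u₀)
                      side-u₁

    linked-P⇒linked-A⊎B : Linked (set rP) u₀ u₁ ≡ true →
                          Linked (set rA) u₀ u₁ ≡ true ⊎ Linked (set rB) u₀ u₁ ≡ true
    linked-P⇒linked-A⊎B linked with Linked (set rA) u₀ u₁ in ¬A | Linked (set rB) u₀ u₁ in ¬B
    ... | true  | _     = inj₁ refl
    ... | false | true  = inj₂ refl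
    ... | false | false = ⊥-elim (bool-absurd linked (Unlinked.unlinked-P ¬A ¬B))

    private
      module A = Smoothing rA (λ ())
      module B = Smoothing rB (λ ())
      module P′ = Smoothing rP (λ ())

    b₁-A⊎B≤b₁-P : b₁ (set rA) ≤ b₁ (set rP) ⊎ b₁ (set rB) ≤ b₁ (set rP)
    b₁-A⊎B≤b₁-P with Linked (set rP) u₀ u₁ in linked
    ... | false = inj₁ (ℕP.≤-trans A.b₁≤b₁-X (ℕP.≤-reflexive (sym (P′.b₁-unlinked linked))))
    ... | true with linked-P⇒linked-A⊎B linked
    ...   | inj₁ linkedA = inj₁ (ℕP.≤-reflexive (trans (A.b₁-linked linkedA) (sym (P′.b₁-linked linked))))
    ...   | inj₂ linkedB = inj₂ (ℕP.≤-reflexive (trans (B.b₁-linked linkedB) (sym (P′.b₁-linked linked))))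

    b₁≤b₁-X : ∀ Y → b₁ (set Y) ≤ b₁ (set rX)
    b₁≤b₁-X rA = A.b₁≤b₁-X
    b₁≤b₁-X rB = B.b₁≤b₁-X
    b₁≤b₁-X rX = ℕP.≤-refl
    b₁≤b₁-X rP = P′.b₁≤b₁-X

    b₁-X≤suc-b₁ : ∀ Y → b₁ (set rX) ≤ suc (b₁ (set Y))
    b₁-X≤suc-b₁ rA = A.b₁-X≤suc-b₁
    b₁-X≤suc-b₁ rB = B.b₁-X≤suc-b₁
    b₁-X≤suc-b₁ rX = ℕP.n≤1+n _
    b₁-X≤suc-b₁ rP = P′.b₁-X≤suc-b₁

module Comparison (D : Diagram) where

  open Resolution D
  open import Data.Nat using (_+_; _*_; _≤_; s≤s)
  import Data.Vec as Vec
  open import Data.Vec.Properties using (lookup-map; map-[]≔)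
  open import Data.List.Membership.Propositional.Properties using (∈-allFin)

  -- σ is turned into τ one crossing of js at a time, each change along ↝ costing at most cost.
  module Along (cost : ℕ) (_↝_ : Res → Res → Set)
               (step : ∀ ρ i {Y Z} → Y ↝ Z → b₁ (ρ [ i ]≔ Y) ≤ cost + b₁ (ρ [ i ]≔ Z)) where

    b₁-along : ∀ js σ τ → (∀ j → j ∉ js → lookup σ j ≡ lookup τ j) →
               (∀ j → lookup σ j ≡ lookup τ j ⊎ lookup σ j ↝ lookup τ j) →
               b₁ σ ≤ length js * cost + b₁ τ
    b₁-along []       σ τ agree _ = ℕP.≤-reflexive (cong b₁ (vec-ext (λ j → agree j (λ ()))))
    b₁-along (i ∷ js) σ τ agree moves = begin
      b₁ σ                                ≤⟨ first ⟩
      cost + b₁ σ₁                        ≤⟨ ℕP.+-monoʳ-≤ cost (b₁-along js σ₁ τ agree₁ moves₁) ⟩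
      cost + (length js * cost + b₁ τ)    ≡⟨ sym (ℕP.+-assoc cost _ _) ⟩
      length (i ∷ js) * cost + b₁ τ       ∎
      where
      open ℕP.≤-Reasoning
      σ₁ : State
      σ₁ = σ [ i ]≔ lookup τ i
      first : b₁ σ ≤ cost + b₁ σ₁
      first with moves i
      ... | inj₁ same = ℕP.≤-trans (ℕP.≤-reflexive (cong b₁ (sym (set-lookup σ i same)))) (ℕP.m≤n+m _ cost)
      ... | inj₂ move = subst (λ ρ → b₁ ρ ≤ cost + b₁ σ₁) (set-lookup σ i refl) (step σ i move)
      agree₁ : ∀ j → j ∉ js → lookup σ₁ j ≡ lookup τ j
      agree₁ j j∉js with lookup-set σ i (lookup τ i) j
      ... | inj₁ (refl , at-i)     = at-i
      ... | inj₂ (j≢i , elsewhere) = trans elsewhere (agree j (∉-∷ j≢i j∉js))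
      moves₁ : ∀ j → lookup σ₁ j ≡ lookup τ j ⊎ lookup σ₁ j ↝ lookup τ j
      moves₁ j with lookup-set σ i (lookup τ i) j
      ... | inj₁ (refl , at-i)     = inj₁ at-i
      ... | inj₂ (j≢i , elsewhere) rewrite elsewhere = moves j

  b₁-mono-X : ∀ σ τ → (∀ j → lookup σ j ≡ lookup τ j ⊎ lookup τ j ≡ rX) → b₁ σ ≤ b₁ τ
  b₁-mono-X σ τ moves =
    subst (λ n → b₁ σ ≤ n + b₁ τ) (ℕP.*-zeroʳ (length (allFin (nc D))))
      (Along.b₁-along 0 (λ _ Z → Z ≡ rX) (λ { ρ i {Y} refl → AtCrossing.b₁≤b₁-X ρ i Y })
                      (allFin (nc D)) σ τ (λ j j∉ → ⊥-elim (j∉ (∈-allFin j))) moves)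

  b₁-X≤length+b₁ : ∀ js σ τ → (∀ j → j ∉ js → lookup σ j ≡ lookup τ j) →
           (∀ j → lookup σ j ≡ lookup τ j ⊎ lookup σ j ≡ rX) → b₁ σ ≤ length js + b₁ τ
  b₁-X≤length+b₁ js σ τ agree moves =
    subst (λ n → b₁ σ ≤ n + b₁ τ) (ℕP.*-identityʳ (length js))
      (Along.b₁-along 1 (λ Y _ → Y ≡ rX) (λ { ρ i {Z = Z} refl → AtCrossing.b₁-X≤suc-b₁ ρ i Z })
                      js σ τ agree moves)

  b₁≤suc-b₁-set : ∀ ρ i Z → b₁ ρ ≤ suc (b₁ (ρ [ i ]≔ Z))
  b₁≤suc-b₁-set ρ i Z = begin
    b₁ ρ                        ≡⟨ cong b₁ (sym (set-lookup ρ i refl)) ⟩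
    b₁ (ρ [ i ]≔ lookup ρ i)    ≤⟨ AtCrossing.b₁≤b₁-X ρ i (lookup ρ i) ⟩
    b₁ (ρ [ i ]≔ rX)            ≤⟨ AtCrossing.b₁-X≤suc-b₁ ρ i Z ⟩
    suc (b₁ (ρ [ i ]≔ Z))       ∎
    where open ℕP.≤-Reasoning

  P≔ : Res → Res → Res
  P≔ Y rP = Y
  P≔ Y r  = r

  _⟨P≔_⟩ : State → Res → State
  σ ⟨P≔ Y ⟩ = Vec.map (P≔ Y) σ

  private
    P? : ∀ r → r ≡ rP ⊎ r ≢ rP
    P? rA = inj₂ (λ ())
    P? rB = inj₂ (λ ())
    P? rX = inj₂ (λ ())
    P? rP = inj₁ refl

    P≔-other : ∀ Y {r} → r ≢ rP → P≔ Y r ≡ r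
    P≔-other Y {rA} _   = refl
    P≔-other Y {rB} _   = refl
    P≔-other Y {rX} _   = refl
    P≔-other Y {rP} r≢P = ⊥-elim (r≢P refl)

    P≔-idem : ∀ Y → P≔ Y Y ≡ Y
    P≔-idem rA = refl
    P≔-idem rB = refl
    P≔-idem rX = refl
    P≔-idem rP = refl

    P≔-kept : ∀ Y σ i → lookup σ i ≡ rP → (σ [ i ]≔ Y) ⟨P≔ Y ⟩ ≡ σ ⟨P≔ Y ⟩
    P≔-kept Y σ i σi≡P =
      trans (map-[]≔ (P≔ Y) σ i)
            (set-lookup (σ ⟨P≔ Y ⟩) i (trans (lookup-map i (P≔ Y) σ) (trans (cong (P≔ Y) σi≡P) (sym (P≔-idem Y)))))

    b₁-P≔-moved : ∀ Y σ i Z → Z ≢ rP → b₁ (σ ⟨P≔ Y ⟩) ≤ suc (b₁ ((σ [ i ]≔ Z) ⟨P≔ Y ⟩))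
    b₁-P≔-moved Y σ i Z Z≢P =
      subst (λ ρ → _ ≤ suc (b₁ ρ)) (sym (trans (map-[]≔ (P≔ Y) σ i) (cong (σ ⟨P≔ Y ⟩ [ i ]≔_) (P≔-other Y Z≢P))))
            (b₁≤suc-b₁-set (σ ⟨P≔ Y ⟩) i Z)

    noP-set : ∀ {cs} (σ : State) i Y → Y ≢ rP → (∀ j → j ∉ i ∷ cs → lookup σ j ≢ rP) → ∀ j → j ∉ cs → lookup (σ [ i ]≔ Y) j ≢ rP
    noP-set σ i Y Y≢P noP j j∉cs with lookup-set σ i Y j
    ... | inj₁ (refl , at-i)     = λ P → Y≢P (trans (sym at-i) P)
    ... | inj₂ (j≢i , elsewhere) = λ P → noP j (∉-∷ j≢i j∉cs) (trans (sym elsewhere) P)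

    pair-step : ∀ {a b a′ b′ p p′ L} → a ≡ a′ → b ≤ suc b′ → a′ + b′ ≤ L + (p′ + p′) → p′ ≤ p →
                a + b ≤ suc L + (p + p)
    pair-step {a} {b} {a′} {b′} {p} {p′} {L} refl b≤ ind p′≤p = begin
      a + b                ≤⟨ ℕP.+-monoʳ-≤ a b≤ ⟩
      a + suc b′           ≡⟨ ℕP.+-suc a b′ ⟩
      suc (a + b′)         ≤⟨ s≤s ind ⟩
      suc (L + (p′ + p′))  ≤⟨ s≤s (ℕP.+-monoʳ-≤ L (ℕP.+-mono-≤ p′≤p p′≤p)) ⟩
      suc L + (p + p)      ∎
      where open ℕP.≤-Reasoning

  -- At each P-crossing one of the two smoothings does not raise b₁ (b₁-A⊎B≤b₁-P), and the other
  -- raises it by at most one.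
  b₁-smoothings : ∀ cs σ → (∀ j → j ∉ cs → lookup σ j ≢ rP) →
                  b₁ (σ ⟨P≔ rA ⟩) + b₁ (σ ⟨P≔ rB ⟩) ≤ length cs + (b₁ σ + b₁ σ)
  b₁-smoothings [] σ noP =
    ℕP.≤-reflexive (cong₂ _+_ (cong b₁ (unchanged rA)) (cong b₁ (unchanged rB)))
    where
    unchanged : ∀ Y → σ ⟨P≔ Y ⟩ ≡ σ
    unchanged Y = vec-ext (λ j → trans (lookup-map j (P≔ Y) σ) (P≔-other Y (noP j (λ ()))))
  b₁-smoothings (i ∷ cs) σ noP with P? (lookup σ i)
  ... | inj₂ σi≢P = ℕP.≤-trans (b₁-smoothings cs σ noP′) (ℕP.+-monoˡ-≤ (b₁ σ + b₁ σ) (ℕP.n≤1+n (length cs)))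
    where
    noP′ : ∀ j → j ∉ cs → lookup σ j ≢ rP
    noP′ j j∉cs with j ≟ᶠ i
    ... | yes refl = σi≢P
    ... | no j≢i   = noP j (∉-∷ j≢i j∉cs)
  ... | inj₁ σi≡P with AtCrossing.b₁-A⊎B≤b₁-P σ i
  ...   | inj₁ A≤P =
    pair-step {L = length cs} (cong b₁ (sym (P≔-kept rA σ i σi≡P))) (b₁-P≔-moved rB σ i rA (λ ()))
              (b₁-smoothings cs τ (noP-set σ i rA (λ ()) noP))
              (subst (λ ρ → b₁ τ ≤ b₁ ρ) (set-lookup σ i σi≡P) A≤P)
    where
    τ = σ [ i ]≔ rA
  ...   | inj₂ B≤P =
    subst (_≤ suc (length cs) + (b₁ σ + b₁ σ)) (ℕP.+-comm (b₁ (σ ⟨P≔ rB ⟩)) (b₁ (σ ⟨P≔ rA ⟩)))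
      (pair-step {L = length cs} (cong b₁ (sym (P≔-kept rB σ i σi≡P))) (b₁-P≔-moved rA σ i rB (λ ()))
                 (subst (_≤ length cs + (b₁ τ + b₁ τ)) (ℕP.+-comm (b₁ (τ ⟨P≔ rA ⟩)) (b₁ (τ ⟨P≔ rB ⟩)))
                        (b₁-smoothings cs τ (noP-set σ i rB (λ ()) noP)))
                 (subst (λ ρ → b₁ τ ≤ b₁ ρ) (set-lookup σ i σi≡P) B≤P))
    where
    τ = σ [ i ]≔ rB

module Counting where

  open import Data.Nat using (_+_; _≤_; z≤n)
  open import Data.Vec as Vec using (Vec; []; _∷_; lookup)
  open import Algebra.Properties.CommutativeSemigroup ℕP.+-commutativeSemigroup using (interchange; x∙yz≈y∙xz)

  bit : Bool → ℕ
  bit true  = 1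
  bit false = 0

  module _ {A : Set} where

    positions : ∀ {n} → (A → Bool) → Vec A n → List (Fin n)
    positions p []       = []
    positions p (x ∷ xs) = if p x then zero ∷ map suc (positions p xs) else map suc (positions p xs)

    ∈-positions⁺ : ∀ p {n} (xs : Vec A n) j → p (lookup xs j) ≡ true → j ∈ positions p xs
    ∈-positions⁺ p (x ∷ xs) zero    px rewrite px = here refl
    ∈-positions⁺ p (x ∷ xs) (suc j) pxⱼ with p x
    ... | true  = there (∈-map⁺ suc (∈-positions⁺ p xs j pxⱼ))
    ... | false = ∈-map⁺ suc (∈-positions⁺ p xs j pxⱼ)

    length-positions-∷ : ∀ p {n} x (xs : Vec A n) →
                         length (positions p (x ∷ xs)) ≡ bit (p x) + length (positions p xs)
    length-positions-∷ p x xs with p x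
    ... | true  = cong suc (length-map suc (positions p xs))
    ... | false = length-map suc (positions p xs)

    length-positions : ∀ p {n} (xs : Vec A n) →
                       length (positions p xs) + length (positions (λ x → not (p x)) xs) ≡ n
    length-positions p []       = refl
    length-positions p (x ∷ xs)
      rewrite length-positions-∷ p x xs | length-positions-∷ (λ x → not (p x)) x xs with p x
    ... | true  = cong suc (length-positions p xs)
    ... | false = trans (ℕP.+-suc _ _) (cong suc (length-positions p xs))

  isA isB : Res → Bool
  isA rA = true
  isA _  = false
  isB rB = true
  isB _  = false

  isAB : Res → Res → Bool
  isAB s t = isA s ∧ isB t

  isAB⇒ : ∀ s t → isAB s t ≡ true → s ≡ rA × t ≡ rB
  isAB⇒ rA rB _ = refl , refl

  count-rA-∷ : ∀ s {n} (S : Vec Res n) → count rA (s ∷ S) ≡ bit (isA s) + count rA S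
  count-rA-∷ rA S = refl
  count-rA-∷ rB S = refl
  count-rA-∷ rX S = refl
  count-rA-∷ rP S = refl

  count-rB-∷ : ∀ s {n} (S : Vec Res n) → count rB (s ∷ S) ≡ bit (isB s) + count rB S
  count-rB-∷ rA S = refl
  count-rB-∷ rB S = refl
  count-rB-∷ rX S = refl
  count-rB-∷ rP S = refl

  bit+bit≤ : ∀ a b → bit a + bit b ≤ 1 + bit (a ∧ b)
  bit+bit≤ true  true  = ℕP.≤-refl
  bit+bit≤ true  false = ℕP.≤-refl
  bit+bit≤ false true  = ℕP.≤-refl
  bit+bit≤ false false = z≤n

  ABs : ∀ {n} → Vec Res n → Vec Res n → List (Fin n)
  ABs S T = positions (λ b → b) (Vec.zipWith isAB S T)

  -- inclusion–exclusion: the A-crossings of S and B-crossings of T overlap in the AB-crossings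
  count-A+count-B≤ : ∀ {n} (S T : Vec Res n) → count rA S + count rB T ≤ n + length (ABs S T)
  count-A+count-B≤ []      []      = z≤n
  count-A+count-B≤ {suc n} (s ∷ S) (t ∷ T) = begin
    count rA (s ∷ S) + count rB (t ∷ T)
      ≡⟨ cong₂ _+_ (count-rA-∷ s S) (count-rB-∷ t T) ⟩
    (bit (isA s) + count rA S) + (bit (isB t) + count rB T)
      ≡⟨ interchange (bit (isA s)) (count rA S) (bit (isB t)) (count rB T) ⟩
    (bit (isA s) + bit (isB t)) + (count rA S + count rB T)
      ≤⟨ ℕP.+-mono-≤ (bit+bit≤ (isA s) (isB t)) (count-A+count-B≤ S T) ⟩
    (1 + bit (isAB s t)) + (n + length (ABs S T))
      ≡⟨ cong suc (x∙yz≈y∙xz (bit (isAB s t)) n (length (ABs S T))) ⟩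
    suc n + (bit (isAB s t) + length (ABs S T))
      ≡⟨ cong (suc n +_) (sym (length-positions-∷ (λ b → b) (isAB s t) (Vec.zipWith isAB S T))) ⟩
    suc n + length (ABs (s ∷ S) (t ∷ T))
      ∎
    where open ℕP.≤-Reasoning

module Pairwise (D : Diagram) (S T : Vec Res (nc D)) where

  open Resolution D
  open Comparison D
  open Counting
  open import Data.Nat using (_+_; _*_; _≤_)
  open import Data.Vec as Vec using (Vec; lookup)
  open import Data.Vec.Properties using (lookup-map; lookup-zipWith; lookup-replicate)
  open import Data.Nat.Tactic.RingSolver using (solve-∀)

  private
    ab : Vec Bool (nc D)
    ab = Vec.zipWith isAB S T

    ds : List (Fin (nc D))
    ds = positions not ab

  σP : State
  σP = Vec.map (λ b → if b then rP else rX) ab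

  private
    data Crossing (j : Fin (nc D)) : Set where
      smoothed : lookup S j ≡ rA → lookup T j ≡ rB → lookup σP j ≡ rP → j ∈ ABs S T → Crossing j
      vertex   : lookup σP j ≡ rX → j ∈ ds → Crossing j

    crossing : ∀ j → Crossing j
    crossing j with lookup ab j in abⱼ
    ... | true  = smoothed (proj₁ (isAB⇒ _ _ isABⱼ)) (proj₂ (isAB⇒ _ _ isABⱼ))
                           (trans (lookup-map j _ ab) (cong (λ b → if b then rP else rX) abⱼ))
                           (∈-positions⁺ (λ b → b) ab j abⱼ)
      where
      isABⱼ : isAB (lookup S j) (lookup T j) ≡ true
      isABⱼ = trans (sym (lookup-zipWith isAB j S T)) abⱼ
    ... | false = vertex (trans (lookup-map j _ ab) (cong (λ b → if b then rP else rX) abⱼ))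
                         (∈-positions⁺ not ab j (cong not abⱼ))

    lookup-P≔ : ∀ Y j {r} → lookup σP j ≡ r → lookup (σP ⟨P≔ Y ⟩) j ≡ P≔ Y r
    lookup-P≔ Y j σPⱼ = trans (lookup-map j (P≔ Y) σP) (cong (P≔ Y) σPⱼ)

  b₁-S≤ : b₁ S ≤ b₁ (σP ⟨P≔ rA ⟩)
  b₁-S≤ = b₁-mono-X S (σP ⟨P≔ rA ⟩) moves
    where
    moves : ∀ j → lookup S j ≡ lookup (σP ⟨P≔ rA ⟩) j ⊎ lookup (σP ⟨P≔ rA ⟩) j ≡ rX
    moves j with crossing j
    ... | smoothed Sⱼ _ σPⱼ _ = inj₁ (trans Sⱼ (sym (lookup-P≔ rA j σPⱼ)))
    ... | vertex σPⱼ _        = inj₂ (lookup-P≔ rA j σPⱼ)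

  b₁-T≤ : b₁ T ≤ b₁ (σP ⟨P≔ rB ⟩)
  b₁-T≤ = b₁-mono-X T (σP ⟨P≔ rB ⟩) moves
    where
    moves : ∀ j → lookup T j ≡ lookup (σP ⟨P≔ rB ⟩) j ⊎ lookup (σP ⟨P≔ rB ⟩) j ≡ rX
    moves j with crossing j
    ... | smoothed _ Tⱼ σPⱼ _ = inj₁ (trans Tⱼ (sym (lookup-P≔ rB j σPⱼ)))
    ... | vertex σPⱼ _        = inj₂ (lookup-P≔ rB j σPⱼ)

  b₁-σP-smoothings : b₁ (σP ⟨P≔ rA ⟩) + b₁ (σP ⟨P≔ rB ⟩) ≤ length (ABs S T) + (b₁ σP + b₁ σP)
  b₁-σP-smoothings = b₁-smoothings (ABs S T) σP noP
    where
    noP : ∀ j → j ∉ ABs S T → lookup σP j ≢ rP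
    noP j j∉ with crossing j
    ... | smoothed _ _ _ j∈ = ⊥-elim (j∉ j∈)
    ... | vertex σPⱼ _ rewrite σPⱼ = λ ()

  b₁-σP≤ : b₁ σP ≤ length ds + b₁ allP
  b₁-σP≤ = b₁-X≤length+b₁ ds σP allP agree moves
    where
    agree : ∀ j → j ∉ ds → lookup σP j ≡ lookup allP j
    agree j j∉ with crossing j
    ... | smoothed _ _ σPⱼ _ = trans σPⱼ (sym (lookup-replicate j rP))
    ... | vertex _ j∈        = ⊥-elim (j∉ j∈)
    moves : ∀ j → lookup σP j ≡ lookup allP j ⊎ lookup σP j ≡ rX
    moves j with crossing j
    ... | smoothed _ _ σPⱼ _ = inj₁ (trans σPⱼ (sym (lookup-replicate j rP)))
    ... | vertex σPⱼ _       = inj₂ σPⱼ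

  pairwise : count rA S + count rB T + (b₁ S + b₁ T) ≤ 3 * nc D + 2 * b₁ allP
  pairwise = begin
    count rA S + count rB T + (b₁ S + b₁ T)
      ≤⟨ ℕP.+-mono-≤ (count-A+count-B≤ S T) (ℕP.+-mono-≤ b₁-S≤ b₁-T≤) ⟩
    (n + c) + (b₁ (σP ⟨P≔ rA ⟩) + b₁ (σP ⟨P≔ rB ⟩))
      ≤⟨ ℕP.+-monoʳ-≤ (n + c) b₁-σP-smoothings ⟩
    (n + c) + (c + (b₁ σP + b₁ σP))
      ≤⟨ ℕP.+-monoʳ-≤ (n + c) (ℕP.+-monoʳ-≤ c (ℕP.+-mono-≤ b₁-σP≤ b₁-σP≤)) ⟩
    (n + c) + (c + ((d + g) + (d + g)))
      ≡⟨ regroup n c d g ⟩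
    n + 2 * (c + d) + 2 * g
      ≡⟨ cong (λ m → n + 2 * m + 2 * g) (length-positions (λ b → b) ab) ⟩
    n + 2 * n + 2 * g
      ≡⟨ cong (_+ 2 * g) (triple n) ⟩
    3 * n + 2 * g
      ∎
    where
    open ℕP.≤-Reasoning
    n = nc D
    c = length (ABs S T)
    d = length ds
    g = b₁ allP
    regroup : ∀ n c d g → (n + c) + (c + ((d + g) + (d + g))) ≡ n + 2 * (c + d) + 2 * g
    regroup = solve-∀
    triple : ∀ n → n + 2 * n ≡ 3 * n
    triple = solve-∀

module YamadaExponents (D : Diagram) where

  open Resolution D
  open Exponents
  open import Data.Integer as ℤ using (ℤ; +_; _+_; _-_; -_; _≤_; +≤+)
  import Data.Integer.Properties as ℤP
  open import Data.Integer.Tactic.RingSolver using (solve-∀)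
  open import Data.List.Extrema ℤP.≤-totalOrder using (argmax; f[xs]≤f[argmax])
  import Data.List.Relation.Unary.All as All

  weight : State → ℤ
  weight s = + count rA s - + count rB s

  -- the summand of Defs.yamada, so that yamada D is definitionally sumL (map term states)
  term : State → Laurent
  term s = mulL (monoA (weight s)) (H (resVerts D s) (resEdges D s))

  ExponentsIn-H : ∀ s → ExponentsIn (H (resVerts D s) (resEdges D s)) (- + b₁ s) (+ b₁ s)
  ExponentsIn-H s = ExponentsIn-sumL (map summand (sublists (resEdges D s))) summand-exponents
    where
    summand : List Edge → Laurent
    summand K = mulL (signL (β₀ (resVerts D s) K)) (powL xL (β₁ (resVerts D s) K))
    summand-exponents : ∀ L → L ∈ map summand (sublists (resEdges D s)) → ExponentsIn L (- + b₁ s) (+ b₁ s)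
    summand-exponents L L∈ with ∈-map⁻ summand L∈
    ... | K , K∈ , refl =
      ExponentsIn-weaken (summand K)
        (subst (- + b₁ s ≤_) (sym (ℤP.+-identityˡ _)) (ℤP.neg-mono-≤ (+≤+ K≤)))
        (subst (_≤ + b₁ s) (sym (ℤP.+-identityˡ _)) (+≤+ K≤))
        (ExponentsIn-mulL (signL (β₀ (resVerts D s) K)) (powL xL (β₁ (resVerts D s) K))
                          (ExponentsIn-signL (β₀ (resVerts D s) K)) (ExponentsIn-powL-xL (β₁ (resVerts D s) K)))
      where
      K≤ : β₁ (resVerts D s) K ℕ.≤ b₁ s
      K≤ = β₁-sublist (resVerts D s) (resEdges D s) K K∈ (resEdges-within s)

  hi lo : State → ℤ
  hi s = weight s + + b₁ s
  lo s = weight s - + b₁ s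

  ExponentsIn-term : ∀ s → ExponentsIn (term s) (lo s) (hi s)
  ExponentsIn-term s =
    ExponentsIn-mulL (monoA (weight s)) (H (resVerts D s) (resEdges D s)) (ExponentsIn-constant (weight s) ℤ.1ℤ) (ExponentsIn-H s)

  width : ℕ
  width = 3 ℕ.* nc D ℕ.+ 2 ℕ.* betti₁ D

  hi≤lo+width : ∀ S T → hi S ≤ lo T + + width
  hi≤lo+width S T = begin
    hi S                                 ≤⟨ ℤP.i≤i+j (hi S) (+ (bS ℕ.+ aT)) ⟩
    hi S + + (bS ℕ.+ aT)                 ≡⟨ rearranged ⟩
    lo T + + (aS ℕ.+ bT ℕ.+ (βS ℕ.+ βT)) ≤⟨ ℤP.+-monoʳ-≤ (lo T) (+≤+ (Pairwise.pairwise D S T)) ⟩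
    lo T + + width                       ∎
    where
    open ℤP.≤-Reasoning
    aS = count rA S
    bS = count rB S
    aT = count rA T
    bT = count rB T
    βS = b₁ S
    βT = b₁ T
    identity : ∀ a b c e f g → ((a - b) + c) + (b + e) ≡ ((e - f) - g) + ((a + f) + (c + g))
    identity = solve-∀
    rearranged : hi S + + (bS ℕ.+ aT) ≡ lo T + + (aS ℕ.+ bT ℕ.+ (βS ℕ.+ βT))
    rearranged = begin-equality
      hi S + + (bS ℕ.+ aT)                         ≡⟨ cong (λ x → hi S + x) (ℤP.pos-+ bS aT) ⟩
      hi S + (+ bS + + aT)                         ≡⟨ identity (+ aS) (+ bS) (+ βS) (+ aT) (+ bT) (+ βT) ⟩
      lo T + ((+ aS + + bT) + (+ βS + + βT))       ≡⟨ cong (λ x → lo T + x) (sym (trans (ℤP.pos-+ (aS ℕ.+ bT) (βS ℕ.+ βT))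
                                                                             (cong₂ _+_ (ℤP.pos-+ aS bT) (ℤP.pos-+ βS βT)))) ⟩
      lo T + + (aS ℕ.+ bT ℕ.+ (βS ℕ.+ βT))         ∎

  states : List State
  states = allVecs (rA ∷ rB ∷ rX ∷ []) (nc D)

  top : ℤ
  top = hi (argmax hi allP states)

  ExponentsIn-yamada : ExponentsIn (yamada D) (top - + width) top
  ExponentsIn-yamada = ExponentsIn-sumL (map term states) summand
    where
    summand : ∀ L → L ∈ map term states → ExponentsIn L (top - + width) top
    summand L L∈ with ∈-map⁻ term L∈
    ... | s , s∈ , refl = ExponentsIn-weaken (term s) top-width≤lo (All.lookup (f[xs]≤f[argmax] allP states) s∈)
                            (ExponentsIn-term s)
      where
      cancel : ∀ a w → (a + w) - w ≡ a
      cancel = solve-∀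
      top-width≤lo : top - + width ≤ lo s
      top-width≤lo = subst (top - + width ≤_) (cancel (lo s) (+ width))
                       (ℤP.+-monoˡ-≤ (- + width) (hi≤lo+width (argmax hi allP states) s))

  span-yamada : span (yamada D) ℕ.≤ width
  span-yamada = ℤP.drop‿+≤+ (subst (+ span (yamada D) ≤_) (difference top (+ width))
                               (span≤ (yamada D) ExponentsIn-yamada (ℤP.i-j≤i top (+ width))))
    where
    difference : ∀ t w → t - (t - w) ≡ w
    difference = solve-∀

open import Data.Nat using (_≤_; _*_; _+_)

theorem5p10 : (D : Diagram) →
    span (yamada D) ≤ 3 * crossings D + 2 * betti₁ D
theorem5p10 D = YamadaExponents.span-yamada D
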